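{- For $n\geq 2$, the number $\kappa_n$ of kernel positions of rank $n$ in the original Bernoulli game is $$\kappa_n=\sum_{k=0}^{n-2}\sum_{1=i_0<i_1<\cdots<i_{k+1}=n}\prod_{j=0}^k (i_{j+1}-i_j-1)!^2\binom{i_{j+1}}{i_j+1}\binom{i_{j+1}}{i_j-1}.$$
   Context: The original Bernoulli game: positions of rank $n\ge1$ are pairs of words $(u_1\cdots u_n, v_1\cdots v_n)$ of positive integers with $1\le u_i,v_i\le i$ for all $i$. A valid move replaces $(u_1\cdots u_n,v_1\cdots v_n)$ by $(u_1\cdots u_m,v_1\cdots v_m)$ for some $1\le m<n$ satisfying $u_{m+1}\le v_j$ for all $j=m+1,\ldots,n$. Players alternate; a player unable to move loses. Kernel positions are positions of Grundy number zero (equivalently, positions from which every valid move leads to a non-kernel position). -}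

module Defs where

open import Data.Nat using (ℕ; zero; suc; _+_; _*_; _∸_; _≤ᵇ_; _!)
open import Data.Nat.Combinatorics using (_C_)
open import Data.Nat.ListAction using (sum)
open import Data.Bool using (Bool; true; false; not; _∨_)
open import Data.List using (List; []; _∷_; [_]; _++_; map; concatMap; length; filter; take; drop; upTo)
open import Data.Bool.ListAction using (and)
open import Data.Bool.Properties using (T?)

-- [ lo , hi ] as a list (empty if hi < lo)
range : ℕ → ℕ → List ℕ
range lo hi = map (lo +_) (upTo (suc hi ∸ lo))

-- all words of length n with 1 ≤ uᵢ ≤ i for all i
words : ℕ → List (List ℕ)
words zero    = [] ∷ []
words (suc n) = concatMap (λ w → map (λ a → w ++ [ a ]) (range 1 (suc n))) (words n)

open import Data.Product using (_×_; _,_)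

Position : Set
Position = List ℕ × List ℕ

positions : ℕ → List Position
positions n = concatMap (λ u → map (λ v → (u , v)) (words n)) (words n)

-- A move from (u₁⋯uₙ, v₁⋯vₙ) to rank m is valid iff 1 ≤ m < n and
-- u_{m+1} ≤ v_j for all j = m+1,…,n.
validMove : ℕ → List ℕ → List ℕ → Bool
validMove zero    u v = false
validMove (suc m) u v with drop (suc m) u
... | []      = false
... | a ∷ _   = and (map (a ≤ᵇ_) (drop (suc m) v))

-- The fuel argument is the
-- rank; recursive calls are on strictly shorter positions, so fuel =
-- rank is always sufficient.
isKernelFuel : ℕ → List ℕ → List ℕ → Bool
isKernelFuel zero    u v = true
isKernelFuel (suc k) u v =
  and (map (λ m → not (validMove m u v) ∨ not (isKernelFuel k (take m u) (take m v)))
           (range 1 (length u ∸ 1)))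

isKernel : Position → Bool
isKernel (u , v) = isKernelFuel (length u) u v

κ : ℕ → ℕ
κ n = length (filter (λ p → T? (isKernel p)) (positions n))

incSeqs : ℕ → ℕ → ℕ → List (List ℕ)
incSeqs zero    lo hi = [] ∷ []
incSeqs (suc k) lo hi =
  concatMap (λ a → map (a ∷_) (incSeqs k (suc a) hi)) (range lo hi)

chains : ℕ → ℕ → List (List ℕ)
chains k n = map (λ s → 1 ∷ s ++ [ n ]) (incSeqs k 2 (n ∸ 1))

factor : ℕ → ℕ → ℕ
factor a b = ((b ∸ a ∸ 1) !) * ((b ∸ a ∸ 1) !) * (b C (a + 1)) * (b C (a ∸ 1))

chainProd : List ℕ → ℕ
chainProd []               = 1
chainProd (a ∷ [])         = 1
chainProd (a ∷ b ∷ rest)   = factor a b * chainProd (b ∷ rest)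

rhs : ℕ → ℕ
rhs n = sum (map (λ k → sum (map chainProd (chains k n))) (upTo (n ∸ 1)))

-- Both sides satisfy the recursion  f n = w 1 n + Σ_{c=2}^{n-1} f c · w c n
-- with weight w = factor, and such a recursion determines f on n ≥ 2
-- ('recursion-unique').
--
-- For κ the recursion comes from a structure theorem for kernel positions
-- ('Prefixes.kernel-count'): a position (u , v) of rank n ≥ 2 is a kernel
-- position iff for exactly one a < n its prefix of rank a is a kernel
-- position and u_{a+1} ≤ v_j for a < j < n while v_n < u_{a+1} (the tail
-- condition); otherwise there is no such a.  Prefix and completion can then
-- be chosen independently, so κ n = Σ_a κ a · tailPairs a (n - a)
-- ('κ-recursion'), and counting completions with rising factorials and the
-- hockey-stick identity gives tailPairs a (n - a) = factor a n.  For the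
-- right-hand side the recursion comes from classifying the chains by their
-- last interior point ('rhs-recursion').

module Submission where

open import Defs
open import Data.Nat using (ℕ; zero; suc; _+_; _*_; _∸_; _≤_; _<_; z≤n; s≤s; _≤ᵇ_; _<ᵇ_; _!)
open import Data.Nat.Properties
open import Data.Nat.Combinatorics using (_C_; nCk≡n!/k![n-k]!; k![n∸k]!∣n!; nCn≡1; k>n⇒nCk≡0; nCk≡nC[n∸k]; nCk+nC[k+1]≡[n+1]C[k+1])
open import Data.Nat.DivMod using (m/n*n≡m)
open import Data.Nat.Induction using (<-rec)
open import Data.Nat.ListAction using (sum)
open import Data.Nat.ListAction.Properties using (sum-++)
open import Data.Bool using (Bool; true; false; not; _∨_; _∧_; T)
open import Data.Bool.Properties using (T?; T-∧)
open import Data.Bool.ListAction using (and; all)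
open import Data.List using (List; []; _∷_; [_]; _++_; map; concatMap; length; filter; take; drop; upTo; applyUpTo)
open import Data.List.Properties using (map-++; map-upTo; ++-identityʳ; ++-assoc; length-++; length-take; take-take; length-drop; map-cong-local; take-all)
open import Data.List.Membership.Propositional using (_∈_)
open import Data.List.Relation.Unary.Any using (here; there)
open import Data.List.Relation.Unary.All as All using (All; []; _∷_)
open import Data.List.Relation.Unary.All.Properties using (map⁺; concat⁺; all⁺; all⁻)
open import Data.Product using (_×_; _,_; proj₁; proj₂; ∃)
open import Data.Sum using (inj₁; inj₂)
open import Data.Empty using (⊥; ⊥-elim)
open import Relation.Nullary using (¬_; yes; no)
open import Relation.Unary using (Decidable)
open import Relation.Binary.Definitions using (tri<; tri≈; tri>)
open import Relation.Binary.PropositionalEquality using (_≡_; _≢_; refl; sym; trans; cong; cong₂; subst; module ≡-Reasoning)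
open import Function using (_∘_)
open import Function.Bundles using (Equivalence)
import Algebra.Properties.CommutativeSemigroup as CommSemigroupProperties

open ≡-Reasoning

∑ : {A : Set} → List A → (A → ℕ) → ℕ
∑ xs g = sum (map g xs)

syntax ∑ xs (λ x → g) = ∑[ x ∈ xs ] g

∑-++ : {A : Set} (xs ys : List A) (g : A → ℕ) → ∑ (xs ++ ys) g ≡ ∑ xs g + ∑ ys g
∑-++ xs ys g = trans (cong sum (map-++ g xs ys)) (sum-++ (map g xs) (map g ys))

∑-map : {A B : Set} (f : A → B) (xs : List A) (g : B → ℕ) → ∑ (map f xs) g ≡ ∑ xs (g ∘ f)
∑-map f []       g = refl
∑-map f (x ∷ xs) g = cong (g (f x) +_) (∑-map f xs g)

∑-concatMap : {A B : Set} (f : A → List B) (xs : List A) (g : B → ℕ) →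
              ∑ (concatMap f xs) g ≡ ∑[ x ∈ xs ] ∑ (f x) g
∑-concatMap f []       g = refl
∑-concatMap f (x ∷ xs) g =
  trans (∑-++ (f x) (concatMap f xs) g) (cong (∑ (f x) g +_) (∑-concatMap f xs g))

∑-cong : {A : Set} {P : A → Set} {g h : A → ℕ} →
         (∀ {x} → P x → g x ≡ h x) → {xs : List A} → All P xs → ∑ xs g ≡ ∑ xs h
∑-cong e []       = refl
∑-cong e (p ∷ ps) = cong₂ _+_ (e p) (∑-cong e ps)

∑-ext : {A : Set} {g h : A → ℕ} → (∀ x → g x ≡ h x) → (xs : List A) → ∑ xs g ≡ ∑ xs h
∑-ext e []       = refl
∑-ext e (x ∷ xs) = cong₂ _+_ (e x) (∑-ext e xs)

∑-zero : {A : Set} (xs : List A) → ∑[ x ∈ xs ] 0 ≡ 0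
∑-zero []       = refl
∑-zero (x ∷ xs) = ∑-zero xs

∑-+ : {A : Set} (g h : A → ℕ) (xs : List A) → ∑[ x ∈ xs ] (g x + h x) ≡ ∑ xs g + ∑ xs h
∑-+ g h []       = refl
∑-+ g h (x ∷ xs) = begin
  g x + h x + ∑[ y ∈ xs ] (g y + h y) ≡⟨ cong (g x + h x +_) (∑-+ g h xs) ⟩
  g x + h x + (∑ xs g + ∑ xs h)       ≡⟨ +-assoc (g x) (h x) _ ⟩
  g x + (h x + (∑ xs g + ∑ xs h))     ≡⟨ cong (g x +_) (x+[y+z]≡y+[x+z] (h x) (∑ xs g) (∑ xs h)) ⟩
  g x + (∑ xs g + (h x + ∑ xs h))     ≡⟨ +-assoc (g x) (∑ xs g) _ ⟨
  g x + ∑ xs g + (h x + ∑ xs h)       ∎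
  where
  x+[y+z]≡y+[x+z] : ∀ a b c → a + (b + c) ≡ b + (a + c)
  x+[y+z]≡y+[x+z] a b c = trans (sym (+-assoc a b c)) (trans (cong (_+ c) (+-comm a b)) (+-assoc b a c))

∑-*ˡ : {A : Set} (c : ℕ) (g : A → ℕ) (xs : List A) → ∑[ x ∈ xs ] (c * g x) ≡ c * ∑ xs g
∑-*ˡ c g []       = sym (*-zeroʳ c)
∑-*ˡ c g (x ∷ xs) = trans (cong (c * g x +_) (∑-*ˡ c g xs)) (sym (*-distribˡ-+ c (g x) (∑ xs g)))

∑-*ʳ : {A : Set} (c : ℕ) (g : A → ℕ) (xs : List A) → ∑[ x ∈ xs ] (g x * c) ≡ ∑ xs g * c
∑-*ʳ c g xs = begin
  ∑[ x ∈ xs ] (g x * c) ≡⟨ ∑-ext (λ x → *-comm (g x) c) xs ⟩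
  ∑[ x ∈ xs ] (c * g x) ≡⟨ ∑-*ˡ c g xs ⟩
  c * ∑ xs g            ≡⟨ *-comm c (∑ xs g) ⟩
  ∑ xs g * c            ∎

∑-swap : {A B : Set} (xs : List A) (ys : List B) (f : A → B → ℕ) →
         ∑[ x ∈ xs ] ∑[ y ∈ ys ] f x y ≡ ∑[ y ∈ ys ] ∑[ x ∈ xs ] f x y
∑-swap []       ys f = sym (∑-zero ys)
∑-swap (x ∷ xs) ys f = begin
  ∑ ys (f x) + ∑[ x′ ∈ xs ] ∑ ys (f x′)               ≡⟨ cong (∑ ys (f x) +_) (∑-swap xs ys f) ⟩
  ∑ ys (f x) + ∑[ y ∈ ys ] ∑[ x′ ∈ xs ] f x′ y         ≡⟨ ∑-+ (f x) (λ y → ∑[ x′ ∈ xs ] f x′ y) ys ⟨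
  ∑[ y ∈ ys ] (f x y + ∑[ x′ ∈ xs ] f x′ y)            ∎

∑-product : {A B : Set} (xs : List A) (ys : List B) (f : A → ℕ) (g : B → ℕ) →
            ∑[ x ∈ xs ] ∑[ y ∈ ys ] (f x * g y) ≡ ∑ xs f * ∑ ys g
∑-product xs ys f g = trans (∑-ext (λ x → ∑-*ˡ (f x) g ys) xs) (∑-*ʳ (∑ ys g) f xs)

𝟙 : Bool → ℕ
𝟙 true  = 1
𝟙 false = 0

𝟙-∧ : ∀ a b → 𝟙 (a ∧ b) ≡ 𝟙 a * 𝟙 b
𝟙-∧ true  b = sym (+-identityʳ (𝟙 b))
𝟙-∧ false b = refl

𝟙-true : ∀ {b} → T b → 𝟙 b ≡ 1
𝟙-true {true} _ = refl

𝟙-false : ∀ {b} → ¬ T b → 𝟙 b ≡ 0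
𝟙-false {false} _     = refl
𝟙-false {true}  ¬true = ⊥-elim (¬true _)

𝟙*𝟙≡0 : ∀ a b → (T a → T b → ⊥) → 𝟙 a * 𝟙 b ≡ 0
𝟙*𝟙≡0 false b     _ = refl
𝟙*𝟙≡0 true  false _ = refl
𝟙*𝟙≡0 true  true  h = ⊥-elim (h _ _)

length-filter : {A : Set} (p : A → Bool) (xs : List A) →
                length (filter (λ x → T? (p x)) xs) ≡ ∑[ x ∈ xs ] 𝟙 (p x)
length-filter p []       = refl
length-filter p (x ∷ xs) with p x
... | true  = cong suc (length-filter p xs)
... | false = length-filter p xs

-- Intervals of consecutive numbers: interval lo n = lo, lo+1, …, lo+n-1.
-- The 'range lo hi' of Defs is converted to this form, which is easier to
-- reason about by induction.

interval : ℕ → ℕ → List ℕ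
interval lo zero    = []
interval lo (suc n) = lo ∷ interval (suc lo) n

applyUpTo-interval : (lo n : ℕ) (f : ℕ → ℕ) → (∀ i → f i ≡ lo + i) → applyUpTo f n ≡ interval lo n
applyUpTo-interval lo zero    f e = refl
applyUpTo-interval lo (suc n) f e = cong₂ _∷_ (trans (e 0) (+-identityʳ lo))
  (applyUpTo-interval (suc lo) n (f ∘ suc) (λ i → trans (e (suc i)) (+-suc lo i)))

range≡interval : (lo hi : ℕ) → range lo hi ≡ interval lo (suc hi ∸ lo)
range≡interval lo hi =
  trans (map-upTo (lo +_) (suc hi ∸ lo)) (applyUpTo-interval lo _ (lo +_) (λ i → refl))

upTo≡interval : (n : ℕ) → upTo n ≡ interval 0 n
upTo≡interval n = applyUpTo-interval 0 n (λ i → i) (λ i → refl)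

interval-++ : (lo m n : ℕ) → interval lo (m + n) ≡ interval lo m ++ interval (lo + m) n
interval-++ lo zero    n = cong (λ z → interval z n) (sym (+-identityʳ lo))
interval-++ lo (suc m) n = cong (lo ∷_) (begin
  interval (suc lo) (m + n)                      ≡⟨ interval-++ (suc lo) m n ⟩
  interval (suc lo) m ++ interval (suc lo + m) n ≡⟨ cong (λ z → interval (suc lo) m ++ interval z n) (+-suc lo m) ⟨
  interval (suc lo) m ++ interval (lo + suc m) n ∎)

interval-suc : (lo n : ℕ) → interval (suc lo) n ≡ map suc (interval lo n)
interval-suc lo zero    = refl
interval-suc lo (suc n) = cong (suc lo ∷_) (interval-suc (suc lo) n)

All-interval : (lo n : ℕ) → All (λ m → lo ≤ m × m < lo + n) (interval lo n)
All-interval lo zero    = []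
All-interval lo (suc n) =
  (≤-refl , lo<lo+1+n) ∷ All.map (λ {m} (a , b) → ≤-trans (n≤1+n lo) a , subst (m <_) (sym (+-suc lo n)) b)
                                 (All-interval (suc lo) n)
  where
  lo<lo+1+n : lo < lo + suc n
  lo<lo+1+n = subst (lo <_) (sym (+-suc lo n)) (s≤s (m≤m+n lo n))

∈-interval : (lo n : ℕ) {m : ℕ} → lo ≤ m → m < lo + n → m ∈ interval lo n
∈-interval lo zero    lo≤m m<lo = ⊥-elim (<⇒≱ m<lo (subst (_≤ _) (sym (+-identityʳ lo)) lo≤m))
∈-interval lo (suc n) {m} lo≤m m<lo+1+n with m ≟ lo
... | yes refl = here refl
... | no  m≢lo = there (∈-interval (suc lo) n (≤∧≢⇒< lo≤m (m≢lo ∘ sym)) (subst (m <_) (+-suc lo n) m<lo+1+n))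

range-bound : (lo hi : ℕ) {m : ℕ} → lo ≤ m → m < lo + (suc hi ∸ lo) → m ≤ hi
range-bound lo hi {m} lo≤m m<end with lo ≤? suc hi
... | yes lo≤1+hi = ≤-pred (subst (m <_) (m+[n∸m]≡n lo≤1+hi) m<end)
... | no  lo≰1+hi = ⊥-elim (<⇒≱ m<end (subst (_≤ m) (sym empty) lo≤m))
  where
  empty : lo + (suc hi ∸ lo) ≡ lo
  empty = trans (cong (lo +_) (m≤n⇒m∸n≡0 (<⇒≤ (≰⇒> lo≰1+hi)))) (+-identityʳ lo)

All-range : (lo hi : ℕ) → All (λ m → lo ≤ m × m ≤ hi) (range lo hi)
All-range lo hi = subst (All _) (sym (range≡interval lo hi))
  (All.map (λ (a , b) → a , range-bound lo hi a b) (All-interval lo (suc hi ∸ lo)))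

∈-range : (lo hi : ℕ) {m : ℕ} → lo ≤ m → m ≤ hi → m ∈ range lo hi
∈-range lo hi {m} lo≤m m≤hi = subst (_ ∈_) (sym (range≡interval lo hi))
  (∈-interval lo _ lo≤m (subst (m <_) (sym (m+[n∸m]≡n (≤-trans lo≤m (m≤n⇒m≤1+n m≤hi)))) (s≤s m≤hi)))

range-empty : (lo hi : ℕ) → hi < lo → range lo hi ≡ []
range-empty lo hi hi<lo = trans (range≡interval lo hi) (cong (interval lo) (m≤n⇒m∸n≡0 hi<lo))

range-cons : ∀ lo hi → lo ≤ hi → range lo hi ≡ lo ∷ range (suc lo) hi
range-cons lo hi lo≤hi = begin
  range lo hi                             ≡⟨ range≡interval lo hi ⟩
  interval lo (suc hi ∸ lo)               ≡⟨ cong (interval lo) (+-∸-assoc 1 lo≤hi) ⟩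
  lo ∷ interval (suc lo) (hi ∸ lo)        ≡⟨ cong (lo ∷_) (range≡interval (suc lo) hi) ⟨
  lo ∷ range (suc lo) hi                  ∎

∑-const : (lo n c : ℕ) → ∑[ _ ∈ interval lo n ] c ≡ n * c
∑-const lo zero    c = refl
∑-const lo (suc n) c = cong (c +_) (∑-const (suc lo) n c)

∑-vanish : {A : Set} {g : A → ℕ} (xs : List A) → (∀ {x} → x ∈ xs → g x ≡ 0) → ∑ xs g ≡ 0
∑-vanish []       h = refl
∑-vanish (x ∷ xs) h = cong₂ _+_ (h (here refl)) (∑-vanish xs (h ∘ there))

∑-single : (lo n : ℕ) (f : ℕ → ℕ) {a₀ : ℕ} → a₀ ∈ interval lo n → f a₀ ≡ 1 →
           (∀ {a} → a ∈ interval lo n → a ≢ a₀ → f a ≡ 0) → ∑ (interval lo n) f ≡ 1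
∑-single lo (suc n) f (here refl) fa₀≡1 others =
  cong₂ _+_ fa₀≡1 (∑-vanish (interval (suc lo) n) (λ a∈ → others (there a∈) (above a∈)))
  where
  above : ∀ {a} → a ∈ interval (suc lo) n → a ≢ lo
  above a∈ a≡lo = <-irrefl (sym a≡lo) (proj₁ (All.lookup (All-interval (suc lo) n) a∈))
∑-single lo (suc n) f (there a₀∈) fa₀≡1 others =
  cong₂ _+_ (others (here refl) (λ lo≡a₀ → below (subst (_∈ _) (sym lo≡a₀) a₀∈)))
            (∑-single (suc lo) n f a₀∈ fa₀≡1 (others ∘ there))
  where
  below : lo ∈ interval (suc lo) n → ⊥
  below lo∈ = <-irrefl refl (proj₁ (All.lookup (All-interval (suc lo) n) lo∈))

-- Words and their extensions.
-- 'extensions c k' lists the words s₀ ⋯ s_{k-1} with 1 ≤ sᵢ ≤ c+1+i: these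
-- are exactly the suffixes that extend a word of length c to a word of
-- length c+k, so that words (c + k) splits as words c × extensions c k.

extensions : ℕ → ℕ → List (List ℕ)
extensions c zero    = [] ∷ []
extensions c (suc k) = concatMap (λ d → map (d ∷_) (extensions (suc c) k)) (range 1 (suc c))

∑-extensions-head : (c k : ℕ) (h : List ℕ → ℕ) →
                    ∑ (extensions c (suc k)) h ≡ ∑[ d ∈ range 1 (suc c) ] ∑[ t ∈ extensions (suc c) k ] h (d ∷ t)
∑-extensions-head c k h = begin
  ∑ (extensions c (suc k)) h
    ≡⟨ ∑-concatMap (λ d → map (d ∷_) (extensions (suc c) k)) (range 1 (suc c)) h ⟩
  ∑[ d ∈ range 1 (suc c) ] ∑ (map (d ∷_) (extensions (suc c) k)) h
    ≡⟨ ∑-ext (λ d → ∑-map (d ∷_) (extensions (suc c) k) h) (range 1 (suc c)) ⟩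
  ∑[ d ∈ range 1 (suc c) ] ∑[ t ∈ extensions (suc c) k ] h (d ∷ t) ∎

∑-extensions-last : (c k : ℕ) (h : List ℕ → ℕ) →
  ∑ (extensions c (suc k)) h ≡ ∑[ s ∈ extensions c k ] ∑[ d ∈ range 1 (suc (c + k)) ] h (s ++ [ d ])
∑-extensions-last c zero h rewrite +-identityʳ c =
  trans (∑-extensions-head c 0 h) (trans (∑-ext (λ d → +-identityʳ (h [ d ])) (range 1 (suc c))) (sym (+-identityʳ _)))
∑-extensions-last c (suc k) h rewrite +-suc c k = begin
  ∑ (extensions c (suc (suc k))) h
    ≡⟨ ∑-extensions-head c (suc k) h ⟩
  ∑[ d ∈ range 1 (suc c) ] ∑[ t ∈ extensions (suc c) (suc k) ] h (d ∷ t)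
    ≡⟨ ∑-ext (λ d → ∑-extensions-last (suc c) k (λ t → h (d ∷ t))) (range 1 (suc c)) ⟩
  ∑[ d ∈ range 1 (suc c) ] ∑[ t ∈ extensions (suc c) k ] ∑[ e ∈ range 1 (suc (suc c + k)) ] h (d ∷ t ++ [ e ])
    ≡⟨ ∑-extensions-head c k (λ s → ∑[ e ∈ range 1 (suc (suc c + k)) ] h (s ++ [ e ])) ⟨
  ∑[ s ∈ extensions c (suc k) ] ∑[ e ∈ range 1 (suc (suc c + k)) ] h (s ++ [ e ]) ∎

∑-words-split : (a k : ℕ) (h : List ℕ → ℕ) →
                ∑ (words (a + k)) h ≡ ∑[ q ∈ words a ] ∑[ s ∈ extensions a k ] h (q ++ s)
∑-words-split a zero h rewrite +-identityʳ a =
  ∑-ext (λ q → sym (trans (+-identityʳ _) (cong h (++-identityʳ q)))) (words a)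
∑-words-split a (suc k) h rewrite +-suc a k = begin
  ∑ (words (suc (a + k))) h
    ≡⟨ ∑-concatMap (λ w → map (λ d → w ++ [ d ]) (range 1 (suc (a + k)))) (words (a + k)) h ⟩
  ∑[ w ∈ words (a + k) ] ∑ (map (λ d → w ++ [ d ]) (range 1 (suc (a + k)))) h
    ≡⟨ ∑-ext (λ w → ∑-map (λ d → w ++ [ d ]) (range 1 (suc (a + k))) h) (words (a + k)) ⟩
  ∑[ w ∈ words (a + k) ] ∑[ d ∈ range 1 (suc (a + k)) ] h (w ++ [ d ])
    ≡⟨ ∑-words-split a k (λ w → ∑[ d ∈ range 1 (suc (a + k)) ] h (w ++ [ d ])) ⟩
  ∑[ q ∈ words a ] ∑[ s ∈ extensions a k ] ∑[ d ∈ range 1 (suc (a + k)) ] h ((q ++ s) ++ [ d ])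
    ≡⟨ ∑-ext (λ q → ∑-ext (λ s → ∑-ext (λ d → cong h (++-assoc q s [ d ]))
                                        (range 1 (suc (a + k)))) (extensions a k)) (words a) ⟩
  ∑[ q ∈ words a ] ∑[ s ∈ extensions a k ] ∑[ d ∈ range 1 (suc (a + k)) ] h (q ++ s ++ [ d ])
    ≡⟨ ∑-ext (λ q → ∑-extensions-last a k (λ s → h (q ++ s))) (words a) ⟨
  ∑[ q ∈ words a ] ∑[ s ∈ extensions a (suc k) ] h (q ++ s) ∎

∑-words-split′ : (a b : ℕ) → a ≤ b → (h : List ℕ → ℕ) →
                 ∑ (words b) h ≡ ∑[ q ∈ words a ] ∑[ s ∈ extensions a (b ∸ a) ] h (q ++ s)
∑-words-split′ a b a≤b h =
  subst (λ b′ → ∑ (words b′) h ≡ ∑[ q ∈ words a ] ∑[ s ∈ extensions a (b ∸ a) ] h (q ++ s))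
        (m+[n∸m]≡n a≤b) (∑-words-split a (b ∸ a) h)

∑-positions : (n : ℕ) (g : Position → ℕ) → ∑ (positions n) g ≡ ∑[ u ∈ words n ] ∑[ v ∈ words n ] g (u , v)
∑-positions n g = trans (∑-concatMap (λ u → map (u ,_) (words n)) (words n) g)
                        (∑-ext (λ u → ∑-map (u ,_) (words n) g) (words n))

All-words-length : (n : ℕ) → All (λ u → length u ≡ n) (words n)
All-words-length zero    = refl ∷ []
All-words-length (suc n) =
  concat⁺ (map⁺ (All.map (λ {w} ∣w∣≡n → map⁺ (All.universal (λ d → len w d ∣w∣≡n) (range 1 (suc n))))
                         (All-words-length n)))
  where
  len : ∀ w d → length w ≡ n → length (w ++ [ d ]) ≡ suc n
  len w d ∣w∣≡n = trans (length-++ w) (trans (cong (_+ 1) ∣w∣≡n) (+-comm n 1))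

All-extensions-length : (c k : ℕ) → All (λ s → length s ≡ k) (extensions c k)
All-extensions-length c zero    = refl ∷ []
All-extensions-length c (suc k) =
  concat⁺ (map⁺ (All.universal (λ d → map⁺ (All.map (cong suc) (All-extensions-length (suc c) k))) (range 1 (suc c))))

-- Entries of a word, indexed from 0 (so 'entry u i' is u_{i+1} of the
-- paper); out of range the entry is 0.

entry : List ℕ → ℕ → ℕ
entry []       j       = 0
entry (x ∷ xs) zero    = x
entry (x ∷ xs) (suc j) = entry xs j

drop-entry : ∀ m (w : List ℕ) → m < length w → drop m w ≡ entry w m ∷ drop (suc m) w
drop-entry zero    (x ∷ w) _         = refl
drop-entry (suc m) (x ∷ w) (s≤s m<∣w∣) = drop-entry m w m<∣w∣

entry-drop : ∀ m (w : List ℕ) i → entry (drop m w) i ≡ entry w (m + i)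
entry-drop zero    w       i = refl
entry-drop (suc m) []      i = refl
entry-drop (suc m) (x ∷ w) i = entry-drop m w i

entry-take : ∀ c (w : List ℕ) {j} → j < c → entry (take c w) j ≡ entry w j
entry-take (suc c) []      _         = refl
entry-take (suc c) (x ∷ w) {zero}  _ = refl
entry-take (suc c) (x ∷ w) {suc j} (s≤s j<c) = entry-take c w j<c

length-take-bound : ∀ c (w : List ℕ) → length (take c w) ≤ c
length-take-bound c w = ≤-trans (≤-reflexive (length-take c w)) (m⊓n≤m c (length w))

length-take-≤ : ∀ c (w : List ℕ) → c ≤ length w → length (take c w) ≡ c
length-take-≤ c w c≤∣w∣ = trans (length-take c w) (m≤n⇒m⊓n≡m c≤∣w∣)

take-take-≤ : ∀ m c (w : List ℕ) → m ≤ c → take m (take c w) ≡ take m w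
take-take-≤ m c w m≤c = trans (take-take m c w) (cong (λ i → take i w) (m≤n⇒m⊓n≡m m≤c))

take-prefix : ∀ {a} (q s : List ℕ) → length q ≡ a → take a (q ++ s) ≡ q
take-prefix []      s refl = refl
take-prefix (x ∷ q) s refl = cong (x ∷_) (take-prefix q s refl)

drop-prefix : ∀ {a} (q s : List ℕ) → length q ≡ a → drop a (q ++ s) ≡ s
drop-prefix []      s refl = refl
drop-prefix (x ∷ q) s refl = drop-prefix q s refl

entry-prefix : ∀ {a} (q s : List ℕ) → length q ≡ a → entry (q ++ s) a ≡ entry s 0
entry-prefix []      s refl = refl
entry-prefix (x ∷ q) s refl = entry-prefix q s refl

all-≤ᵇ-entry : ∀ x (l : List ℕ) → T (all (x ≤ᵇ_) l) → ∀ {i} → i < length l → x ≤ entry l i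
all-≤ᵇ-entry x (y ∷ l) h {zero}  _         = ≤ᵇ⇒≤ x y (proj₁ (Equivalence.to T-∧ h))
all-≤ᵇ-entry x (y ∷ l) h {suc i} (s≤s i<∣l∣) = all-≤ᵇ-entry x l (proj₂ (Equivalence.to T-∧ h)) i<∣l∣

some-entry-below : ∀ x (l : List ℕ) → ¬ T (all (x ≤ᵇ_) l) → ∃ λ i → i < length l × entry l i < x
some-entry-below x []      h = ⊥-elim (h _)
some-entry-below x (y ∷ l) h with x ≤? y
... | no  x≰y = 0 , s≤s z≤n , ≰⇒> x≰y
... | yes x≤y with some-entry-below x l (λ t → h (Equivalence.from T-∧ (≤⇒≤ᵇ x≤y , t)))
... | i , i<∣l∣ , lᵢ<x = suc i , s≤s i<∣l∣ , lᵢ<x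

endsBelow : ℕ → List ℕ → Bool
endsBelow x []          = false
endsBelow x (d ∷ [])    = d <ᵇ x
endsBelow x (d ∷ e ∷ r) = (x ≤ᵇ d) ∧ endsBelow x (e ∷ r)

endsBelow-sound : ∀ x (l : List ℕ) k → length l ≡ suc k → T (endsBelow x l) →
                  (∀ {i} → i < k → x ≤ entry l i) × entry l k < x
endsBelow-sound x (d ∷ [])    zero    _      t = (λ ()) , <ᵇ⇒< d x t
endsBelow-sound x (d ∷ e ∷ r) (suc k) ∣l∣≡2+k t
  with Equivalence.to T-∧ t
... | x≤d , t′ with endsBelow-sound x (e ∷ r) k (suc-injective ∣l∣≡2+k) t′
... | above , last = (λ { {zero} _ → ≤ᵇ⇒≤ x d x≤d ; {suc i} (s≤s i<k) → above i<k }) , last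

endsBelow-complete : ∀ x (l : List ℕ) k → length l ≡ suc k →
                     (∀ {i} → i < k → x ≤ entry l i) → entry l k < x → T (endsBelow x l)
endsBelow-complete x (d ∷ [])    zero    _      _     last = <⇒<ᵇ last
endsBelow-complete x (d ∷ e ∷ r) (suc k) ∣l∣≡2+k above last =
  Equivalence.from T-∧ (≤⇒≤ᵇ (above (s≤s z≤n)) ,
    endsBelow-complete x (e ∷ r) k (suc-injective ∣l∣≡2+k) (λ i<k → above (s≤s i<k)) last)

not∨not-intro : ∀ a b → (T b → ¬ T a) → T (not a ∨ not b)
not∨not-intro false b     _ = _
not∨not-intro true  false _ = _
not∨not-intro true  true  h = h _ _

not∨not-elim : ∀ a b → T (not a ∨ not b) → T b → ¬ T a
not∨not-elim false b     _ _ ()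
not∨not-elim true  false _  ()
not∨not-elim true  true  () _

isKernelFuel-stable : ∀ f g (w z : List ℕ) → length w ≤ f → length w ≤ g →
                      isKernelFuel f w z ≡ isKernelFuel g w z
isKernelFuel-stable zero    zero    w  z _ _ = refl
isKernelFuel-stable zero    (suc g) [] z _ _ = refl
isKernelFuel-stable (suc f) zero    [] z _ _ = refl
isKernelFuel-stable (suc f) (suc g) w  z ∣w∣≤1+f ∣w∣≤1+g =
  cong and (map-cong-local (All.map (λ {m} (_ , m≤∣w∣∸1) →
    cong (λ t → not (validMove m w z) ∨ not t)
         (isKernelFuel-stable f g (take m w) (take m z) (shorter m≤∣w∣∸1 ∣w∣≤1+f) (shorter m≤∣w∣∸1 ∣w∣≤1+g)))
    (All-range 1 (length w ∸ 1))))
  where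
  shorter : ∀ {m k} → m ≤ length w ∸ 1 → length w ≤ suc k → length (take m w) ≤ k
  shorter {m} m≤ ∣w∣≤1+k =
    ≤-trans (length-take-bound m w) (≤-trans m≤ (∸-monoˡ-≤ 1 ∣w∣≤1+k))

isKernel-unfold : ∀ c′ (w z : List ℕ) → length w ≡ suc c′ →
  isKernel (w , z) ≡ all (λ m → not (validMove m w z) ∨ not (isKernel (take m w , take m z))) (range 1 c′)
isKernel-unfold c′ w z ∣w∣≡1+c′ = begin
  isKernelFuel (length w) w z
    ≡⟨ isKernelFuel-stable (length w) (suc c′) w z ≤-refl (≤-reflexive ∣w∣≡1+c′) ⟩
  all (λ m → not (validMove m w z) ∨ not (isKernelFuel c′ (take m w) (take m z))) (range 1 (length w ∸ 1))
    ≡⟨ cong (λ t → all (λ m → not (validMove m w z) ∨ not (isKernelFuel c′ (take m w) (take m z))) (range 1 t))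
            (cong (_∸ 1) ∣w∣≡1+c′) ⟩
  all (λ m → not (validMove m w z) ∨ not (isKernelFuel c′ (take m w) (take m z))) (range 1 c′)
    ≡⟨ cong and (map-cong-local (All.map (λ {m} (_ , m≤c′) → cong (λ t → not (validMove m w z) ∨ not t)
          (isKernelFuel-stable c′ (length (take m w)) (take m w) (take m z)
             (≤-trans (length-take-bound m w) m≤c′) ≤-refl))
          (All-range 1 c′))) ⟩
  all (λ m → not (validMove m w z) ∨ not (isKernel (take m w , take m z))) (range 1 c′) ∎

largest : {P : ℕ → Set} → Decidable P → ∀ {b} t → b ≤ t → P b →
          ∃ λ a → b ≤ a × a ≤ t × P a × (∀ {c} → a < c → c ≤ t → ¬ P c)
largest P? t b≤t pb with P? t
... | yes pt = t , b≤t , ≤-refl , pt , λ t<c c≤t → ⊥-elim (<⇒≱ t<c c≤t)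
largest P? zero    z≤n pb | no ¬pt = ⊥-elim (¬pt pb)
largest {P} P? (suc t) b≤t pb | no ¬pt with m≤n⇒m<n∨m≡n b≤t
... | inj₂ refl = ⊥-elim (¬pt pb)
... | inj₁ b<1+t with largest P? t (≤-pred b<1+t) pb
... | a , b≤a , a≤t , pa , maximal = a , b≤a , m≤n⇒m≤1+n a≤t , pa , maximal′
  where
  maximal′ : ∀ {c} → a < c → c ≤ suc t → ¬ P c
  maximal′ {c} a<c c≤1+t with m≤n⇒m<n∨m≡n c≤1+t
  ... | inj₁ c<1+t = maximal a<c (≤-pred c<1+t)
  ... | inj₂ refl  = ¬pt

-- Throughout, (u , v) is a fixed position of rank n; its prefixes
-- (take c u , take c v) are the positions reachable from it.  Entries are
-- indexed from 0 here, so u_a below is u_{a+1} of the paper.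
module Prefixes (u v : List ℕ) (n : ℕ) (∣u∣≡n : length u ≡ n) (∣v∣≡n : length v ≡ n) where

  kernelᵇ : ℕ → Bool
  kernelᵇ c = isKernel (take c u , take c v)

  Kernel : ℕ → Set
  Kernel c = T (kernelᵇ c)

  Blocked : ℕ → ℕ → Set
  Blocked m c = ∃ λ j → m ≤ j × j < c × entry v j < entry u m

  Blocked-mono : ∀ {m c c′} → c ≤ c′ → Blocked m c → Blocked m c′
  Blocked-mono c≤c′ (j , m≤j , j<c , vⱼ<uₘ) = j , m≤j , ≤-trans j<c c≤c′ , vⱼ<uₘ

  length-take-u : ∀ {c} → c ≤ n → length (take c u) ≡ c
  length-take-u {c} c≤n = length-take-≤ c u (subst (c ≤_) (sym ∣u∣≡n) c≤n)

  length-window : ∀ m {c} → c ≤ n → length (drop m (take c v)) ≡ c ∸ m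
  length-window m {c} c≤n =
    trans (length-drop m (take c v)) (cong (_∸ m) (length-take-≤ c v (subst (c ≤_) (sym ∣v∣≡n) c≤n)))

  validMove-window : ∀ {m c} → 1 ≤ m → m < c → c ≤ n →
    validMove m (take c u) (take c v) ≡ all (entry u m ≤ᵇ_) (drop m (take c v))
  validMove-window {suc m′} {c} _ m<c c≤n
    with drop (suc m′) (take c u) | drop-entry (suc m′) (take c u) (subst (suc m′ <_) (sym (length-take-u c≤n)) m<c)
  ... | _ | refl = cong (λ x → all (x ≤ᵇ_) (drop (suc m′) (take c v))) (entry-take c u m<c)

  invalid⇒blocked : ∀ {m c} → 1 ≤ m → m < c → c ≤ n → ¬ T (validMove m (take c u) (take c v)) → Blocked m c
  invalid⇒blocked {m} {c} 1≤m m<c c≤n invalid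
    with some-entry-below (entry u m) (drop m (take c v)) (subst (¬_ ∘ T) (validMove-window 1≤m m<c c≤n) invalid)
  ... | i , i<len , entry<uₘ = m + i , m≤m+n m i , m+i<c , subst (_< entry u m) entry-eq entry<uₘ
    where
    m+i<c : m + i < c
    m+i<c = subst (m + i <_) (m+[n∸m]≡n (<⇒≤ m<c)) (+-monoʳ-< m (subst (i <_) (length-window m c≤n) i<len))
    entry-eq : entry (drop m (take c v)) i ≡ entry v (m + i)
    entry-eq = trans (entry-drop m (take c v) i) (entry-take c v m+i<c)

  blocked⇒invalid : ∀ {m c} → 1 ≤ m → m < c → c ≤ n → Blocked m c → ¬ T (validMove m (take c u) (take c v))
  blocked⇒invalid {m} {c} 1≤m m<c c≤n (j , m≤j , j<c , vⱼ<uₘ) valid =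
    <⇒≱ vⱼ<uₘ (subst (entry u m ≤_) entry-eq
      (all-≤ᵇ-entry (entry u m) (drop m (take c v)) (subst T (validMove-window 1≤m m<c c≤n) valid) i<len))
    where
    i<len : j ∸ m < length (drop m (take c v))
    i<len = subst (j ∸ m <_) (sym (length-window m c≤n)) (∸-monoˡ-< j<c m≤j)
    entry-eq : entry (drop m (take c v)) (j ∸ m) ≡ entry v j
    entry-eq = trans (entry-drop m (take c v) (j ∸ m)) (trans (cong (entry (take c v)) (m+[n∸m]≡n m≤j)) (entry-take c v j<c))

  kernelᵇ-unfold : ∀ c′ → suc c′ ≤ n →
    kernelᵇ (suc c′) ≡ all (λ m → not (validMove m (take (suc c′) u) (take (suc c′) v)) ∨ not (kernelᵇ m)) (range 1 c′)
  kernelᵇ-unfold c′ c≤n =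
    trans (isKernel-unfold c′ (take (suc c′) u) (take (suc c′) v) (length-take-u c≤n))
      (cong and (map-cong-local (All.map (λ {m} (_ , m≤c′) →
         cong₂ (λ u′ v′ → not (validMove m (take (suc c′) u) (take (suc c′) v)) ∨ not (isKernel (u′ , v′)))
           (take-take-≤ m (suc c′) u (m≤n⇒m≤1+n m≤c′)) (take-take-≤ m (suc c′) v (m≤n⇒m≤1+n m≤c′)))
         (All-range 1 c′))))

  kernel⇒blocked : ∀ {m c} → Kernel c → c ≤ n → 1 ≤ m → m < c → Kernel m → Blocked m c
  kernel⇒blocked {m} {suc c′} kernel c≤n 1≤m (s≤s m≤c′) kernel-m =
    invalid⇒blocked 1≤m (s≤s m≤c′) c≤n
      (not∨not-elim _ (kernelᵇ m) (All.lookup clauses (∈-range 1 c′ 1≤m m≤c′)) kernel-m)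
    where
    clauses : All (λ m′ → T (not (validMove m′ (take (suc c′) u) (take (suc c′) v)) ∨ not (kernelᵇ m′))) (range 1 c′)
    clauses = all⁺ _ (range 1 c′) (subst T (kernelᵇ-unfold c′ c≤n) kernel)

  blocked⇒kernel : ∀ {c} → 1 ≤ c → c ≤ n → (∀ {m} → 1 ≤ m → m < c → Kernel m → Blocked m c) → Kernel c
  blocked⇒kernel {suc c′} _ c≤n blocked = subst T (sym (kernelᵇ-unfold c′ c≤n))
    (all⁻ _ (All.map (λ {m} (1≤m , m≤c′) → not∨not-intro _ (kernelᵇ m)
                        (λ kernel-m → blocked⇒invalid 1≤m (s≤s m≤c′) c≤n (blocked 1≤m (s≤s m≤c′) kernel-m)))
                     (All-range 1 c′)))

  -- The tail condition on a rank a < n: u_a ≤ v_j for a ≤ j < n-1 and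
  -- v_{n-1} < u_a (0-indexed), i.e. the move from rank n to rank a is
  -- blocked by the last letter of v only.
  Tail : ℕ → Set
  Tail a = (∀ {j} → a ≤ j → suc j < n → entry u a ≤ entry v j) × entry v (n ∸ 1) < entry u a

  tail⇒no-kernel-above : ∀ {a c} → 1 ≤ a → Kernel a → Tail a → a < c → c < n → ¬ Kernel c
  tail⇒no-kernel-above 1≤a kernel-a (above , _) a<c c<n kernel-c
    with kernel⇒blocked kernel-c (<⇒≤ c<n) 1≤a a<c kernel-a
  ... | j , a≤j , j<c , vⱼ<uₐ = <⇒≱ vⱼ<uₐ (above a≤j (≤-trans (s≤s j<c) c<n))

  -- A prefix c above a kernel prefix a is a kernel prefix as soon as no
  -- prefix strictly between them is one and the move from c to a is blocked:
  -- moves to kernel prefixes below a are already blocked within a.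
  kernel-above : ∀ {a c} → 1 ≤ a → Kernel a → a < c → c ≤ n →
                 (∀ {m} → a < m → m < c → ¬ Kernel m) → Blocked a c → Kernel c
  kernel-above {a} {c} 1≤a kernel-a a<c c≤n none-between blocked-a =
    blocked⇒kernel (≤-trans 1≤a (<⇒≤ a<c)) c≤n blocked
    where
    blocked : ∀ {m} → 1 ≤ m → m < c → Kernel m → Blocked m c
    blocked {m} 1≤m m<c kernel-m with <-cmp m a
    ... | tri< m<a _ _    = Blocked-mono (<⇒≤ a<c) (kernel⇒blocked kernel-a (≤-trans (<⇒≤ a<c) c≤n) 1≤m m<a kernel-m)
    ... | tri≈ _ refl _   = blocked-a
    ... | tri> _ _ a<m    = ⊥-elim (none-between a<m m<c kernel-m)

  tail⇒kernel : ∀ {a} → 1 ≤ a → a < n → Kernel a → Tail a → Kernel n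
  tail⇒kernel {a} 1≤a a<n kernel-a tail@(_ , last) =
    kernel-above 1≤a kernel-a a<n ≤-refl (tail⇒no-kernel-above 1≤a kernel-a tail) blocked-by-last
    where
    n≡1+[n∸1] : suc (n ∸ 1) ≡ n
    n≡1+[n∸1] = m+[n∸m]≡n (≤-trans 1≤a (<⇒≤ a<n))
    blocked-by-last : Blocked a n
    blocked-by-last = n ∸ 1 , ≤-pred (subst (a <_) (sym n≡1+[n∸1]) a<n) , subst (n ∸ 1 <_) n≡1+[n∸1] ≤-refl , last

  -- Rank 1 admits no move, so its prefix is a kernel position.
  kernel-1 : 1 ≤ n → Kernel 1
  kernel-1 1≤n = blocked⇒kernel ≤-refl 1≤n (λ 1≤m m<1 → ⊥-elim (<⇒≱ m<1 1≤m))

  -- Conversely, a kernel position of rank n ≥ 2 has a kernel prefix with the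
  -- tail condition: the largest kernel prefix of rank < n.
  kernel⇒tail : 2 ≤ n → Kernel n → ∃ λ a → 1 ≤ a × a < n × Kernel a × Tail a
  kernel⇒tail 2≤n kernel-n
    with largest (λ c → T? (kernelᵇ c)) (n ∸ 1) (∸-monoˡ-≤ 1 2≤n) (kernel-1 (≤-trans (s≤s z≤n) 2≤n))
  ... | a , 1≤a , a≤n∸1 , kernel-a , maximal = a , 1≤a , a<n , kernel-a , above , last
    where
    1≤n : 1 ≤ n
    1≤n = ≤-trans (s≤s z≤n) 2≤n
    a<n : a < n
    a<n = subst (a <_) (m+[n∸m]≡n 1≤n) (s≤s a≤n∸1)
    above : ∀ {j} → a ≤ j → suc j < n → entry u a ≤ entry v j
    above {j} a≤j 1+j<n with entry u a ≤? entry v j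
    ... | yes uₐ≤vⱼ = uₐ≤vⱼ
    ... | no  uₐ≰vⱼ = ⊥-elim (maximal (s≤s a≤j) 1+j≤n∸1 (kernel-above 1≤a kernel-a (s≤s a≤j) (<⇒≤ 1+j<n)
            (λ a<m m<1+j → maximal a<m (≤-trans (<⇒≤ m<1+j) 1+j≤n∸1)) (j , a≤j , ≤-refl , ≰⇒> uₐ≰vⱼ)))
      where
      1+j≤n∸1 : suc j ≤ n ∸ 1
      1+j≤n∸1 = ≤-pred (subst (suc (suc j) ≤_) (sym (m+[n∸m]≡n 1≤n)) 1+j<n)
    last : entry v (n ∸ 1) < entry u a
    last with kernel⇒blocked kernel-n ≤-refl 1≤a a<n kernel-a
    ... | j , a≤j , j<n , vⱼ<uₐ with suc j <? n
    ... | yes 1+j<n = ⊥-elim (<⇒≱ vⱼ<uₐ (above a≤j 1+j<n))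
    ... | no  1+j≮n = subst (λ i → entry v i < entry u a) j≡n∸1 vⱼ<uₐ
      where
      j≡n∸1 : j ≡ n ∸ 1
      j≡n∸1 = cong (_∸ 1) (≤-antisym j<n (≮⇒≥ 1+j≮n))

  tailᵇ : ℕ → Bool
  tailᵇ a = endsBelow (entry u a) (drop a v)

  module _ {a k : ℕ} (n≡a+1+k : n ≡ a + suc k) where

    length-drop-v : length (drop a v) ≡ suc k
    length-drop-v = trans (length-drop a v) (trans (cong (_∸ a) (trans ∣v∣≡n n≡a+1+k)) (m+n∸m≡n a (suc k)))

    last-index : a + k ≡ n ∸ 1
    last-index = sym (trans (cong (_∸ 1) n≡a+1+k) (+-∸-assoc a {suc k} {1} (s≤s z≤n)))

    tailᵇ⇒Tail : T (tailᵇ a) → Tail a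
    tailᵇ⇒Tail t with endsBelow-sound (entry u a) (drop a v) k length-drop-v t
    ... | above , last = above′ , subst (_< entry u a) (trans (entry-drop a v k) (cong (entry v) last-index)) last
      where
      above′ : ∀ {j} → a ≤ j → suc j < n → entry u a ≤ entry v j
      above′ {j} a≤j 1+j<n = subst (entry u a ≤_) (trans (entry-drop a v (j ∸ a)) (cong (entry v) (m+[n∸m]≡n a≤j)))
        (above (subst (j ∸ a <_) (m+n∸m≡n a k) (∸-monoˡ-< j<a+k a≤j)))
        where
        j<a+k : j < a + k
        j<a+k = ≤-pred (subst (suc (suc j) ≤_) (trans n≡a+1+k (+-suc a k)) 1+j<n)

    Tail⇒tailᵇ : Tail a → T (tailᵇ a)
    Tail⇒tailᵇ (above , last) = endsBelow-complete (entry u a) (drop a v) k length-drop-v above′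
      (subst (_< entry u a) (sym (trans (entry-drop a v k) (cong (entry v) last-index))) last)
      where
      above′ : ∀ {i} → i < k → entry u a ≤ entry (drop a v) i
      above′ {i} i<k = subst (entry u a ≤_) (sym (entry-drop a v i))
        (above (m≤m+n a i) (subst (suc (a + i) <_) (sym (trans n≡a+1+k (+-suc a k))) (s≤s (+-monoʳ-< a i<k))))

  tail-unique : ∀ {a a₀} → 1 ≤ a → a < n → Kernel a → Tail a →
                          1 ≤ a₀ → a₀ < n → Kernel a₀ → Tail a₀ → a ≡ a₀
  tail-unique {a} {a₀} 1≤a a<n kernel-a tail-a 1≤a₀ a₀<n kernel-a₀ tail-a₀ with <-cmp a a₀
  ... | tri< a<a₀ _ _ = ⊥-elim (tail⇒no-kernel-above 1≤a kernel-a tail-a a<a₀ a₀<n kernel-a₀)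
  ... | tri≈ _ a≡a₀ _ = a≡a₀
  ... | tri> _ _ a₀<a = ⊥-elim (tail⇒no-kernel-above 1≤a₀ kernel-a₀ tail-a₀ a₀<a a<n kernel-a)

  split : ∀ {a} → a < n → n ≡ a + suc (n ∸ suc a)
  split {a} a<n = sym (trans (+-suc a (n ∸ suc a)) (m+[n∸m]≡n a<n))

  kernel-count : 2 ≤ n → 𝟙 (kernelᵇ n) ≡ ∑[ a ∈ range 1 (n ∸ 1) ] (𝟙 (kernelᵇ a) * 𝟙 (tailᵇ a))
  kernel-count 2≤n = trans count (cong (λ xs → ∑ xs f) (sym (range≡interval 1 (n ∸ 1))))
    where
    f : ℕ → ℕ
    f a = 𝟙 (kernelᵇ a) * 𝟙 (tailᵇ a)
    1≤n : 1 ≤ n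
    1≤n = ≤-trans (s≤s z≤n) 2≤n
    bounds : ∀ {a} → a ∈ interval 1 (n ∸ 1) → 1 ≤ a × a < n
    bounds a∈ with All.lookup (All-interval 1 (n ∸ 1)) a∈
    ... | 1≤a , a<1+[n∸1] = 1≤a , subst (_ <_) (m+[n∸m]≡n 1≤n) a<1+[n∸1]
    count : 𝟙 (kernelᵇ n) ≡ ∑ (interval 1 (n ∸ 1)) f
    count with T? (kernelᵇ n)
    ... | no ¬kernel-n = trans (𝟙-false ¬kernel-n) (sym (∑-vanish (interval 1 (n ∸ 1)) λ {a} a∈ →
          let 1≤a , a<n = bounds a∈ in
          𝟙*𝟙≡0 (kernelᵇ a) (tailᵇ a)
            (λ kernel-a t → ¬kernel-n (tail⇒kernel 1≤a a<n kernel-a (tailᵇ⇒Tail (split a<n) t)))))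
    ... | yes kernel-n with kernel⇒tail 2≤n kernel-n
    ... | a₀ , 1≤a₀ , a₀<n , kernel-a₀ , tail-a₀ =
      trans (𝟙-true kernel-n) (sym (∑-single 1 (n ∸ 1) f a₀∈ fa₀≡1 others))
      where
      a₀∈ : a₀ ∈ interval 1 (n ∸ 1)
      a₀∈ = ∈-interval 1 (n ∸ 1) 1≤a₀ (subst (a₀ <_) (sym (m+[n∸m]≡n 1≤n)) a₀<n)
      fa₀≡1 : f a₀ ≡ 1
      fa₀≡1 = cong₂ _*_ (𝟙-true kernel-a₀) (𝟙-true (Tail⇒tailᵇ (split a₀<n) tail-a₀))
      others : ∀ {a} → a ∈ interval 1 (n ∸ 1) → a ≢ a₀ → f a ≡ 0
      others {a} a∈ a≢a₀ = 𝟙*𝟙≡0 (kernelᵇ a) (tailᵇ a) λ kernel-a t →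
        let 1≤a , a<n = bounds a∈ in
        a≢a₀ (tail-unique 1≤a a<n kernel-a (tailᵇ⇒Tail (split a<n) t) 1≤a₀ a₀<n kernel-a₀ tail-a₀)

κ-as-sum : ∀ n → κ n ≡ ∑[ u ∈ words n ] ∑[ v ∈ words n ] 𝟙 (isKernel (u , v))
κ-as-sum n = trans (length-filter isKernel (positions n)) (∑-positions n (λ p → 𝟙 (isKernel p)))

-- The number of pairs (s , t) of extensions of length k of words of length
-- a such that t ends below the first letter of s: the number of ways to
-- complete a prefix position of rank a to a position of rank a + k
-- satisfying the tail condition at a.
tailPairs : ℕ → ℕ → ℕ
tailPairs a k = ∑[ s ∈ extensions a k ] ∑[ t ∈ extensions a k ] 𝟙 (endsBelow (entry s 0) t)

kernelWithTail : ℕ → List ℕ → List ℕ → ℕ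
kernelWithTail a u v = 𝟙 (isKernel (take a u , take a v)) * 𝟙 (endsBelow (entry u a) (drop a v))

-- Positions of rank b with a kernel prefix of rank a and the tail condition
-- at a are counted by independent choices of the prefix and the completion.
count-kernel-tail : ∀ a b → a ≤ b →
                    ∑[ u ∈ words b ] ∑[ v ∈ words b ] kernelWithTail a u v ≡ κ a * tailPairs a (b ∸ a)
count-kernel-tail a b a≤b = begin
  ∑[ u ∈ words b ] ∑[ v ∈ words b ] kernelWithTail a u v
    ≡⟨ ∑-words-split′ a b a≤b (λ u → ∑[ v ∈ words b ] kernelWithTail a u v) ⟩
  ∑[ qu ∈ words a ] ∑[ su ∈ exts ] ∑[ v ∈ words b ] kernelWithTail a (qu ++ su) v
    ≡⟨ ∑-ext (λ qu → ∑-ext (λ su → ∑-words-split′ a b a≤b (kernelWithTail a (qu ++ su))) exts) (words a) ⟩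
  ∑[ qu ∈ words a ] ∑[ su ∈ exts ] ∑[ qv ∈ words a ] ∑[ sv ∈ exts ] kernelWithTail a (qu ++ su) (qv ++ sv)
    ≡⟨ ∑-cong (λ {qu} ∣qu∣≡a → ∑-ext (λ su →
         ∑-cong (λ {qv} ∣qv∣≡a → ∑-ext (separate ∣qu∣≡a ∣qv∣≡a su) exts) (All-words-length a)) exts)
       (All-words-length a) ⟩
  ∑[ qu ∈ words a ] ∑[ su ∈ exts ] ∑[ qv ∈ words a ] ∑[ sv ∈ exts ] (kernel qu qv * tail su sv)
    ≡⟨ ∑-ext (λ qu → ∑-swap exts (words a) (λ su qv → ∑[ sv ∈ exts ] (kernel qu qv * tail su sv))) (words a) ⟩
  ∑[ qu ∈ words a ] ∑[ qv ∈ words a ] ∑[ su ∈ exts ] ∑[ sv ∈ exts ] (kernel qu qv * tail su sv)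
    ≡⟨ ∑-ext (λ qu → ∑-ext (λ qv → trans (∑-ext (λ su → ∑-*ˡ (kernel qu qv) (tail su) exts) exts)
                                         (∑-*ˡ (kernel qu qv) (λ su → ∑ exts (tail su)) exts)) (words a)) (words a) ⟩
  ∑[ qu ∈ words a ] ∑[ qv ∈ words a ] (kernel qu qv * tailPairs a (b ∸ a))
    ≡⟨ ∑-ext (λ qu → ∑-*ʳ (tailPairs a (b ∸ a)) (kernel qu) (words a)) (words a) ⟩
  ∑[ qu ∈ words a ] ((∑[ qv ∈ words a ] kernel qu qv) * tailPairs a (b ∸ a))
    ≡⟨ ∑-*ʳ (tailPairs a (b ∸ a)) (λ qu → ∑[ qv ∈ words a ] kernel qu qv) (words a) ⟩
  (∑[ qu ∈ words a ] ∑[ qv ∈ words a ] kernel qu qv) * tailPairs a (b ∸ a)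
    ≡⟨ cong (_* tailPairs a (b ∸ a)) (κ-as-sum a) ⟨
  κ a * tailPairs a (b ∸ a) ∎
  where
  exts : List (List ℕ)
  exts = extensions a (b ∸ a)
  kernel : List ℕ → List ℕ → ℕ
  kernel qu qv = 𝟙 (isKernel (qu , qv))
  tail : List ℕ → List ℕ → ℕ
  tail su sv = 𝟙 (endsBelow (entry su 0) sv)
  separate : ∀ {qu qv} → length qu ≡ a → length qv ≡ a → ∀ su sv →
             kernelWithTail a (qu ++ su) (qv ++ sv) ≡ kernel qu qv * tail su sv
  separate {qu} {qv} ∣qu∣≡a ∣qv∣≡a su sv =
    cong₂ (λ p e → 𝟙 (isKernel p) * 𝟙 e)
      (cong₂ _,_ (take-prefix qu su ∣qu∣≡a) (take-prefix qv sv ∣qv∣≡a))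
      (cong₂ endsBelow (entry-prefix qu su ∣qu∣≡a) (drop-prefix qv sv ∣qv∣≡a))

κ-recursion : ∀ b → 2 ≤ b → κ b ≡ ∑[ a ∈ range 1 (b ∸ 1) ] (κ a * tailPairs a (b ∸ a))
κ-recursion b 2≤b = begin
  κ b
    ≡⟨ κ-as-sum b ⟩
  ∑[ u ∈ words b ] ∑[ v ∈ words b ] 𝟙 (isKernel (u , v))
    ≡⟨ ∑-cong (λ {u} ∣u∣≡b → ∑-cong (λ {v} ∣v∣≡b → decompose {u} {v} ∣u∣≡b ∣v∣≡b) (All-words-length b))
              (All-words-length b) ⟩
  ∑[ u ∈ words b ] ∑[ v ∈ words b ] ∑[ a ∈ ranks ] kernelWithTail a u v
    ≡⟨ ∑-ext (λ u → ∑-swap (words b) ranks (λ v a → kernelWithTail a u v)) (words b) ⟩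
  ∑[ u ∈ words b ] ∑[ a ∈ ranks ] ∑[ v ∈ words b ] kernelWithTail a u v
    ≡⟨ ∑-swap (words b) ranks (λ u a → ∑[ v ∈ words b ] kernelWithTail a u v) ⟩
  ∑[ a ∈ ranks ] ∑[ u ∈ words b ] ∑[ v ∈ words b ] kernelWithTail a u v
    ≡⟨ ∑-cong (λ {a} (_ , a≤b∸1) → count-kernel-tail a b (≤-trans a≤b∸1 (m∸n≤m b 1))) (All-range 1 (b ∸ 1)) ⟩
  ∑[ a ∈ ranks ] (κ a * tailPairs a (b ∸ a)) ∎
  where
  ranks : List ℕ
  ranks = range 1 (b ∸ 1)
  decompose : ∀ {u v} → length u ≡ b → length v ≡ b → 𝟙 (isKernel (u , v)) ≡ ∑[ a ∈ ranks ] kernelWithTail a u v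
  decompose {u} {v} ∣u∣≡b ∣v∣≡b =
    trans (cong₂ (λ u′ v′ → 𝟙 (isKernel (u′ , v′))) (sym (take-all b u (≤-reflexive ∣u∣≡b)))
                                                     (sym (take-all b v (≤-reflexive ∣v∣≡b))))
          (Prefixes.kernel-count u v b ∣u∣≡b ∣v∣≡b 2≤b)

-- Counting completions.
-- rising c m = (c+1)(c+2)⋯(c+m) is the number of extensions of length m
-- of a word of length c.

rising : ℕ → ℕ → ℕ
rising c zero    = 1
rising c (suc m) = suc c * rising (suc c) m

∑-extensions-const : ∀ c m K → ∑[ _ ∈ extensions c m ] K ≡ rising c m * K
∑-extensions-const c zero    K = trans (+-identityʳ K) (sym (+-identityʳ K))
∑-extensions-const c (suc m) K = begin
  ∑[ _ ∈ extensions c (suc m) ] K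
    ≡⟨ ∑-extensions-head c m (λ _ → K) ⟩
  ∑[ _ ∈ range 1 (suc c) ] ∑[ _ ∈ extensions (suc c) m ] K
    ≡⟨ ∑-ext (λ _ → ∑-extensions-const (suc c) m K) (range 1 (suc c)) ⟩
  ∑[ _ ∈ range 1 (suc c) ] (rising (suc c) m * K)
    ≡⟨ cong (λ xs → ∑[ _ ∈ xs ] (rising (suc c) m * K)) (range≡interval 1 (suc c)) ⟩
  ∑[ _ ∈ interval 1 (suc c) ] (rising (suc c) m * K)
    ≡⟨ ∑-const 1 (suc c) (rising (suc c) m * K) ⟩
  suc c * (rising (suc c) m * K)
    ≡⟨ *-assoc (suc c) (rising (suc c) m) K ⟨
  rising c (suc m) * K ∎

endingBelow : ℕ → ℕ → ℕ → ℕ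
endingBelow c k x = ∑[ t ∈ extensions c k ] 𝟙 (endsBelow x t)

endingBelow-1 : ∀ c x → endingBelow c 1 x ≡ ∑[ d ∈ range 1 (suc c) ] 𝟙 (d <ᵇ x)
endingBelow-1 c x = trans (∑-extensions-head c 0 (λ t → 𝟙 (endsBelow x t)))
                          (∑-ext (λ d → +-identityʳ (𝟙 (d <ᵇ x))) (range 1 (suc c)))

endingBelow-suc : ∀ c k x → endingBelow c (suc (suc k)) x ≡
                  (∑[ d ∈ range 1 (suc c) ] 𝟙 (x ≤ᵇ d)) * endingBelow (suc c) (suc k) x
endingBelow-suc c k x = begin
  endingBelow c (suc (suc k)) x
    ≡⟨ ∑-extensions-head c (suc k) (λ t → 𝟙 (endsBelow x t)) ⟩
  ∑[ d ∈ range 1 (suc c) ] ∑[ t ∈ extensions (suc c) (suc k) ] 𝟙 (endsBelow x (d ∷ t))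
    ≡⟨ ∑-ext (λ d → ∑-cong (λ {t} → first-letter d {t}) (All-extensions-length (suc c) (suc k))) (range 1 (suc c)) ⟩
  ∑[ d ∈ range 1 (suc c) ] ∑[ t ∈ extensions (suc c) (suc k) ] (𝟙 (x ≤ᵇ d) * 𝟙 (endsBelow x t))
    ≡⟨ ∑-product (range 1 (suc c)) (extensions (suc c) (suc k)) (λ d → 𝟙 (x ≤ᵇ d)) (λ t → 𝟙 (endsBelow x t)) ⟩
  (∑[ d ∈ range 1 (suc c) ] 𝟙 (x ≤ᵇ d)) * endingBelow (suc c) (suc k) x ∎
  where
  first-letter : ∀ d {t} → length t ≡ suc k → 𝟙 (endsBelow x (d ∷ t)) ≡ 𝟙 (x ≤ᵇ d) * 𝟙 (endsBelow x t)
  first-letter d {e ∷ r} _ = 𝟙-∧ (x ≤ᵇ d) (endsBelow x (e ∷ r))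

module _ (y r : ℕ) where

  letters-split : ∀ (g : ℕ → ℕ) → ∑ (range 1 (suc (y + r))) g ≡ ∑ (interval 1 y) g + ∑ (interval (suc y) (suc r)) g
  letters-split g = begin
    ∑ (range 1 (suc (y + r))) g                          ≡⟨ cong (λ xs → ∑ xs g) (range≡interval 1 (suc (y + r))) ⟩
    ∑ (interval 1 (suc (y + r))) g                       ≡⟨ cong (λ xs → ∑ xs g) (cong (interval 1) (+-suc y r)) ⟨
    ∑ (interval 1 (y + suc r)) g                         ≡⟨ cong (λ xs → ∑ xs g) (interval-++ 1 y (suc r)) ⟩
    ∑ (interval 1 y ++ interval (suc y) (suc r)) g       ≡⟨ ∑-++ (interval 1 y) _ g ⟩
    ∑ (interval 1 y) g + ∑ (interval (suc y) (suc r)) g ∎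

  count-below : ∑[ d ∈ range 1 (suc (y + r)) ] 𝟙 (d <ᵇ suc y) ≡ y
  count-below = begin
    ∑[ d ∈ range 1 (suc (y + r)) ] 𝟙 (d <ᵇ suc y)
      ≡⟨ letters-split (λ d → 𝟙 (d <ᵇ suc y)) ⟩
    ∑[ d ∈ interval 1 y ] 𝟙 (d <ᵇ suc y) + ∑[ d ∈ interval (suc y) (suc r) ] 𝟙 (d <ᵇ suc y)
      ≡⟨ cong₂ _+_ (∑-cong (λ (_ , d<1+y) → 𝟙-true (<⇒<ᵇ d<1+y)) (All-interval 1 y))
                   (∑-cong (λ (1+y≤d , _) → 𝟙-false (<⇒≱ (s≤s 1+y≤d) ∘ <ᵇ⇒< _ _)) (All-interval (suc y) (suc r))) ⟩
    ∑[ _ ∈ interval 1 y ] 1 + ∑[ _ ∈ interval (suc y) (suc r) ] 0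
      ≡⟨ cong₂ _+_ (∑-const 1 y 1) (∑-zero (interval (suc y) (suc r))) ⟩
    y * 1 + 0
      ≡⟨ trans (+-identityʳ (y * 1)) (*-identityʳ y) ⟩
    y ∎

  count-above : ∑[ d ∈ range 1 (suc (y + r)) ] 𝟙 (suc y ≤ᵇ d) ≡ suc r
  count-above = begin
    ∑[ d ∈ range 1 (suc (y + r)) ] 𝟙 (suc y ≤ᵇ d)
      ≡⟨ letters-split (λ d → 𝟙 (suc y ≤ᵇ d)) ⟩
    ∑[ d ∈ interval 1 y ] 𝟙 (suc y ≤ᵇ d) + ∑[ d ∈ interval (suc y) (suc r) ] 𝟙 (suc y ≤ᵇ d)
      ≡⟨ cong₂ _+_ (∑-cong (λ (_ , d<1+y) → 𝟙-false (<⇒≱ d<1+y ∘ ≤ᵇ⇒≤ _ _)) (All-interval 1 y))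
                   (∑-cong (λ (1+y≤d , _) → 𝟙-true (≤⇒≤ᵇ 1+y≤d)) (All-interval (suc y) (suc r))) ⟩
    ∑[ _ ∈ interval 1 y ] 0 + ∑[ _ ∈ interval (suc y) (suc r) ] 1
      ≡⟨ cong₂ _+_ (∑-zero (interval 1 y)) (∑-const (suc y) (suc r) 1) ⟩
    suc r * 1
      ≡⟨ *-identityʳ (suc r) ⟩
    suc r ∎

endingBelow-closed : ∀ k y r → endingBelow (y + r) (suc k) (suc y) ≡ y * rising r k
endingBelow-closed zero    y r = trans (endingBelow-1 (y + r) (suc y)) (trans (count-below y r) (sym (*-identityʳ y)))
endingBelow-closed (suc k) y r = begin
  endingBelow (y + r) (suc (suc k)) (suc y)
    ≡⟨ endingBelow-suc (y + r) k (suc y) ⟩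
  (∑[ d ∈ range 1 (suc (y + r)) ] 𝟙 (suc y ≤ᵇ d)) * endingBelow (suc (y + r)) (suc k) (suc y)
    ≡⟨ cong₂ _*_ (count-above y r) (cong (λ c → endingBelow c (suc k) (suc y)) (sym (+-suc y r))) ⟩
  suc r * endingBelow (y + suc r) (suc k) (suc y)
    ≡⟨ cong (suc r *_) (endingBelow-closed k y (suc r)) ⟩
  suc r * (y * rising (suc r) k)
    ≡⟨ x∙yz≈y∙xz (suc r) y (rising (suc r) k) ⟩
  y * rising r (suc k) ∎
  where open CommSemigroupProperties *-commutativeSemigroup using (x∙yz≈y∙xz)

-- Summing over the first letter d = y + 1 of the completion of u.
tailPairs-rising : ∀ a k → tailPairs a (suc k) ≡ rising (suc a) k * ∑[ y ∈ interval 0 (suc a) ] (y * rising (a ∸ y) k)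
tailPairs-rising a k = begin
  tailPairs a (suc k)
    ≡⟨ ∑-extensions-head a k (λ s → endingBelow a (suc k) (entry s 0)) ⟩
  ∑[ d ∈ range 1 (suc a) ] ∑[ _ ∈ extensions (suc a) k ] endingBelow a (suc k) d
    ≡⟨ ∑-ext (λ d → ∑-extensions-const (suc a) k (endingBelow a (suc k) d)) (range 1 (suc a)) ⟩
  ∑[ d ∈ range 1 (suc a) ] (rising (suc a) k * endingBelow a (suc k) d)
    ≡⟨ ∑-*ˡ (rising (suc a) k) (endingBelow a (suc k)) (range 1 (suc a)) ⟩
  rising (suc a) k * ∑ (range 1 (suc a)) (endingBelow a (suc k))
    ≡⟨ cong (rising (suc a) k *_) first-letters ⟩
  rising (suc a) k * ∑[ y ∈ interval 0 (suc a) ] (y * rising (a ∸ y) k) ∎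
  where
  first-letters : ∑ (range 1 (suc a)) (endingBelow a (suc k)) ≡ ∑[ y ∈ interval 0 (suc a) ] (y * rising (a ∸ y) k)
  first-letters = begin
    ∑ (range 1 (suc a)) (endingBelow a (suc k))
      ≡⟨ cong (λ xs → ∑ xs (endingBelow a (suc k))) (trans (range≡interval 1 (suc a)) (interval-suc 0 (suc a))) ⟩
    ∑ (map suc (interval 0 (suc a))) (endingBelow a (suc k))
      ≡⟨ ∑-map suc (interval 0 (suc a)) (endingBelow a (suc k)) ⟩
    ∑[ y ∈ interval 0 (suc a) ] endingBelow a (suc k) (suc y)
      ≡⟨ ∑-cong (λ {y} (_ , y<1+a) → subst (λ c → endingBelow c (suc k) (suc y) ≡ y * rising (a ∸ y) k)
                                          (m+[n∸m]≡n (≤-pred y<1+a)) (endingBelow-closed k y (a ∸ y)))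
                (All-interval 0 (suc a)) ⟩
    ∑[ y ∈ interval 0 (suc a) ] (y * rising (a ∸ y) k) ∎

C-factorial : ∀ {n k} → k ≤ n → (n C k) * (k ! * (n ∸ k) !) ≡ n !
C-factorial {n} {k} k≤n = trans (cong (_* (k ! * (n ∸ k) !)) (nCk≡n!/k![n-k]! k≤n)) (m/n*n≡m (k![n∸k]!∣n! k≤n))
  where instance _ = k !* (n ∸ k) !≢0

rising-factorial : ∀ c m → rising c m * c ! ≡ (c + m) !
rising-factorial c zero    = trans (+-identityʳ (c !)) (cong _! (sym (+-identityʳ c)))
rising-factorial c (suc m) = begin
  suc c * rising (suc c) m * c ! ≡⟨ xy∙z≈xz∙y (suc c) (rising (suc c) m) (c !) ⟩
  suc c * c ! * rising (suc c) m ≡⟨ *-comm (suc c !) (rising (suc c) m) ⟩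
  rising (suc c) m * suc c !     ≡⟨ rising-factorial (suc c) m ⟩
  (suc c + m) !                  ≡⟨ cong _! (+-suc c m) ⟨
  (c + suc m) !                  ∎
  where open CommSemigroupProperties *-commutativeSemigroup using (xy∙z≈xz∙y)

rising≡binomial : ∀ c m → rising c m ≡ m ! * ((c + m) C m)
rising≡binomial c m = *-cancelʳ-≡ (rising c m) (m ! * ((c + m) C m)) (c !) {{c !≢0}} (begin
  rising c m * c !                          ≡⟨ rising-factorial c m ⟩
  (c + m) !                                 ≡⟨ C-factorial (m≤n+m m c) ⟨
  ((c + m) C m) * (m ! * (c + m ∸ m) !)       ≡⟨ cong (λ i → ((c + m) C m) * (m ! * i !)) (m+n∸n≡m c m) ⟩
  ((c + m) C m) * (m ! * c !)                 ≡⟨ *-assoc ((c + m) C m) (m !) (c !) ⟨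
  ((c + m) C m) * m ! * c !                   ≡⟨ cong (_* c !) (*-comm ((c + m) C m) (m !)) ⟩
  m ! * ((c + m) C m) * c !                   ∎)

hockey-stick : ∀ a m → ∑[ y ∈ interval 0 (suc a) ] ((a ∸ y + m) C m) ≡ (suc (a + m) C suc m)
hockey-stick zero    m = trans (+-identityʳ (m C m)) (trans (nCn≡1 m) (sym (nCn≡1 (suc m))))
hockey-stick (suc a) m = begin
  ((suc a + m) C m) + ∑[ y ∈ interval 1 (suc a) ] ((suc a ∸ y + m) C m)
    ≡⟨ cong ((suc a + m) C m +_) (trans (cong (λ xs → ∑[ y ∈ xs ] ((suc a ∸ y + m) C m)) (interval-suc 0 (suc a)))
                                        (∑-map suc (interval 0 (suc a)) (λ y → ((suc a ∸ y + m) C m)))) ⟩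
  ((suc a + m) C m) + ∑[ y ∈ interval 0 (suc a) ] ((a ∸ y + m) C m)
    ≡⟨ cong ((suc a + m) C m +_) (hockey-stick a m) ⟩
  (suc (a + m) C m) + (suc (a + m) C suc m)
    ≡⟨ nCk+nC[k+1]≡[n+1]C[k+1] (suc (a + m)) m ⟩
  (suc (suc a + m) C suc m) ∎

weighted-hockey-stick : ∀ a m → ∑[ y ∈ interval 0 (suc a) ] (y * ((a ∸ y + m) C m)) ≡ (suc (a + m) C suc (suc m))
weighted-hockey-stick zero    m = sym (k>n⇒nCk≡0 (n<1+n (suc m)))
weighted-hockey-stick (suc a) m = begin
  ∑[ y ∈ interval 1 (suc a) ] (y * ((suc a ∸ y + m) C m))
    ≡⟨ cong (λ xs → ∑[ y ∈ xs ] (y * ((suc a ∸ y + m) C m))) (interval-suc 0 (suc a)) ⟩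
  ∑[ y ∈ map suc (interval 0 (suc a)) ] (y * ((suc a ∸ y + m) C m))
    ≡⟨ ∑-map suc (interval 0 (suc a)) (λ y → y * ((suc a ∸ y + m) C m)) ⟩
  ∑[ y ∈ interval 0 (suc a) ] (((a ∸ y + m) C m) + y * ((a ∸ y + m) C m))
    ≡⟨ ∑-+ (λ y → ((a ∸ y + m) C m)) (λ y → y * ((a ∸ y + m) C m)) (interval 0 (suc a)) ⟩
  ∑[ y ∈ interval 0 (suc a) ] ((a ∸ y + m) C m) + ∑[ y ∈ interval 0 (suc a) ] (y * ((a ∸ y + m) C m))
    ≡⟨ cong₂ _+_ (hockey-stick a m) (weighted-hockey-stick a m) ⟩
  (suc (a + m) C suc m) + (suc (a + m) C suc (suc m))
    ≡⟨ nCk+nC[k+1]≡[n+1]C[k+1] (suc (a + m)) (suc m) ⟩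
  (suc (suc a + m) C suc (suc m)) ∎

tailPairs-closed : ∀ a k → tailPairs a (suc k) ≡ (k ! * (suc (a + k) C k)) * (k ! * (suc (a + k) C suc (suc k)))
tailPairs-closed a k = begin
  tailPairs a (suc k)
    ≡⟨ tailPairs-rising a k ⟩
  rising (suc a) k * ∑[ y ∈ interval 0 (suc a) ] (y * rising (a ∸ y) k)
    ≡⟨ cong₂ _*_ (rising≡binomial (suc a) k)
                 (∑-ext (λ y → cong (y *_) (rising≡binomial (a ∸ y) k)) (interval 0 (suc a))) ⟩
  k ! * (suc (a + k) C k) * ∑[ y ∈ interval 0 (suc a) ] (y * (k ! * ((a ∸ y + k) C k)))
    ≡⟨ cong (k ! * (suc (a + k) C k) *_) (trans (∑-ext (λ y → x∙yz≈y∙xz y (k !) ((a ∸ y + k) C k)) (interval 0 (suc a)))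
                                              (∑-*ˡ (k !) (λ y → y * ((a ∸ y + k) C k)) (interval 0 (suc a)))) ⟩
  k ! * (suc (a + k) C k) * (k ! * ∑[ y ∈ interval 0 (suc a) ] (y * ((a ∸ y + k) C k)))
    ≡⟨ cong (λ z → k ! * (suc (a + k) C k) * (k ! * z)) (weighted-hockey-stick a k) ⟩
  k ! * (suc (a + k) C k) * (k ! * (suc (a + k) C suc (suc k))) ∎
  where open CommSemigroupProperties *-commutativeSemigroup using (x∙yz≈y∙xz)

tailPairs≡factor : ∀ a b → 1 ≤ a → a < b → tailPairs a (b ∸ a) ≡ factor a b
tailPairs≡factor a@(suc a′) b _ a<b = begin
  tailPairs a (b ∸ a)
    ≡⟨ cong (tailPairs a) b∸a≡1+k ⟩
  tailPairs a (suc k)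
    ≡⟨ tailPairs-closed a k ⟩
  (k ! * (suc (a + k) C k)) * (k ! * (suc (a + k) C suc (suc k)))
    ≡⟨ cong (λ c → (k ! * (c C k)) * (k ! * (c C suc (suc k)))) (sym b≡1+a+k) ⟩
  (k ! * (b C k)) * (k ! * (b C suc (suc k)))
    ≡⟨ interchange (k !) (b C k) (k !) (b C suc (suc k)) ⟩
  k ! * k ! * ((b C k) * (b C suc (suc k)))
    ≡⟨ *-assoc (k ! * k !) (b C k) (b C suc (suc k)) ⟨
  k ! * k ! * (b C k) * (b C suc (suc k))
    ≡⟨ cong₂ (λ x y → k ! * k ! * x * y) (sym C-upper) (sym C-lower) ⟩
  k ! * k ! * (b C (a + 1)) * (b C (a ∸ 1))
    ≡⟨ cong (λ i → i ! * i ! * (b C (a + 1)) * (b C (a ∸ 1))) (cong (_∸ 1) b∸a≡1+k) ⟨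
  factor a b ∎
  where
  open CommSemigroupProperties *-commutativeSemigroup using (interchange)
  k : ℕ
  k = b ∸ suc a
  b≡1+a+k : b ≡ suc (a + k)
  b≡1+a+k = sym (m+[n∸m]≡n a<b)
  b∸a≡1+k : b ∸ a ≡ suc k
  b∸a≡1+k = trans (cong (_∸ a) (trans b≡1+a+k (sym (+-suc a k)))) (m+n∸m≡n a (suc k))
  -- the two binomials of the factor, by symmetry C(b, i) = C(b, b - i)
  C-upper : (b C (a + 1)) ≡ (b C k)
  C-upper = begin
    (b C (a + 1))       ≡⟨ nCk≡nC[n∸k] (subst (_≤ b) (+-comm 1 a) a<b) ⟩
    (b C (b ∸ (a + 1))) ≡⟨ cong (λ i → (b C (b ∸ i))) (+-comm a 1) ⟩
    (b C k)             ∎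
  C-lower : (b C (a ∸ 1)) ≡ (b C suc (suc k))
  C-lower = begin
    (b C a′)            ≡⟨ nCk≡nC[n∸k] (≤-trans (n≤1+n a′) (<⇒≤ a<b)) ⟩
    (b C (b ∸ a′))      ≡⟨ cong (λ c → (b C (c ∸ a′))) (trans b≡1+a+k (cong suc (sym (+-suc a′ k)))) ⟩
    (b C (suc (a′ + suc k) ∸ a′))
                      ≡⟨ cong (b C_) (trans (cong (_∸ a′) (sym (+-suc a′ (suc k)))) (m+n∸m≡n a′ (suc (suc k)))) ⟩
    (b C suc (suc k))   ∎

∑-triangle : ∀ lo N (G : ℕ → ℕ → ℕ) →
  ∑[ a ∈ interval lo N ] ∑[ c ∈ interval (suc a) (lo + N ∸ suc a) ] G a c
  ≡ ∑[ c ∈ interval lo N ] ∑[ a ∈ interval lo (c ∸ lo) ] G a c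
∑-triangle lo zero    G = refl
∑-triangle lo (suc N) G = begin
  ∑[ c ∈ interval (suc lo) (lo + suc N ∸ suc lo) ] G lo c + ∑[ a ∈ interval (suc lo) N ] ∑[ c ∈ interval (suc a) (lo + suc N ∸ suc a) ] G a c
    ≡⟨ cong₂ _+_ (cong (λ t → ∑ (interval (suc lo) (t ∸ suc lo)) (G lo)) (+-suc lo N))
                 (cong (λ t → ∑[ a ∈ interval (suc lo) N ] ∑[ c ∈ interval (suc a) (t ∸ suc a) ] G a c) (+-suc lo N)) ⟩
  ∑[ c ∈ interval (suc lo) (suc lo + N ∸ suc lo) ] G lo c + ∑[ a ∈ interval (suc lo) N ] ∑[ c ∈ interval (suc a) (suc lo + N ∸ suc a) ] G a c
    ≡⟨ cong₂ _+_ (cong (λ t → ∑ (interval (suc lo) t) (G lo)) (m+n∸m≡n (suc lo) N)) (∑-triangle (suc lo) N G) ⟩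
  ∑[ c ∈ interval (suc lo) N ] G lo c + ∑[ c ∈ interval (suc lo) N ] ∑[ a ∈ interval (suc lo) (c ∸ suc lo) ] G a c
    ≡⟨ ∑-+ (G lo) (λ c → ∑[ a ∈ interval (suc lo) (c ∸ suc lo) ] G a c) (interval (suc lo) N) ⟨
  ∑[ c ∈ interval (suc lo) N ] ∑[ a ∈ interval lo (suc (c ∸ suc lo)) ] G a c
    ≡⟨ ∑-cong (λ {c} (1+lo≤c , _) → cong (λ t → ∑[ a ∈ interval lo t ] G a c) (sym (+-∸-assoc 1 1+lo≤c))) (All-interval (suc lo) N) ⟩
  ∑[ c ∈ interval (suc lo) N ] ∑[ a ∈ interval lo (c ∸ lo) ] G a c
    ≡⟨ cong (_+ ∑[ c ∈ interval (suc lo) N ] ∑[ a ∈ interval lo (c ∸ lo) ] G a c)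
            (cong (λ t → ∑[ a ∈ interval lo t ] G a lo) (n∸n≡0 lo)) ⟨
  ∑[ c ∈ interval lo (suc N) ] ∑[ a ∈ interval lo (c ∸ lo) ] G a c ∎

∑-triangle-range : ∀ lo hi (G : ℕ → ℕ → ℕ) → 1 ≤ lo →
  ∑[ a ∈ range lo hi ] ∑[ c ∈ range (suc a) hi ] G a c ≡ ∑[ c ∈ range lo hi ] ∑[ a ∈ range lo (c ∸ 1) ] G a c
∑-triangle-range lo hi G 1≤lo with lo ≤? suc hi
... | no  lo≰1+hi rewrite range-empty lo hi (<⇒≤ (≰⇒> lo≰1+hi)) = refl
... | yes lo≤1+hi = begin
  ∑[ a ∈ range lo hi ] ∑[ c ∈ range (suc a) hi ] G a c
    ≡⟨ cong (λ xs → ∑[ a ∈ xs ] ∑[ c ∈ range (suc a) hi ] G a c) (range≡interval lo hi) ⟩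
  ∑[ a ∈ interval lo N ] ∑[ c ∈ range (suc a) hi ] G a c
    ≡⟨ ∑-ext (λ a → cong (λ xs → ∑ xs (G a)) (trans (range≡interval (suc a) hi)
                     (cong (λ t → interval (suc a) (t ∸ suc a)) (sym (m+[n∸m]≡n lo≤1+hi))))) (interval lo N) ⟩
  ∑[ a ∈ interval lo N ] ∑[ c ∈ interval (suc a) (lo + N ∸ suc a) ] G a c
    ≡⟨ ∑-triangle lo N G ⟩
  ∑[ c ∈ interval lo N ] ∑[ a ∈ interval lo (c ∸ lo) ] G a c
    ≡⟨ ∑-cong (λ {c} (lo≤c , _) → cong (λ xs → ∑[ a ∈ xs ] G a c)
                (sym (trans (range≡interval lo (c ∸ 1)) (cong (λ t → interval lo (t ∸ lo)) (m+[n∸m]≡n (≤-trans 1≤lo lo≤c))))))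
              (All-interval lo N) ⟩
  ∑[ c ∈ interval lo N ] ∑[ a ∈ range lo (c ∸ 1) ] G a c
    ≡⟨ cong (λ xs → ∑[ c ∈ xs ] ∑[ a ∈ range lo (c ∸ 1) ] G a c) (range≡interval lo hi) ⟨
  ∑[ c ∈ range lo hi ] ∑[ a ∈ range lo (c ∸ 1) ] G a c ∎
  where
  N : ℕ
  N = suc hi ∸ lo

∑-incSeqs-head : ∀ k lo hi (h : List ℕ → ℕ) →
  ∑ (incSeqs (suc k) lo hi) h ≡ ∑[ a ∈ range lo hi ] ∑[ t ∈ incSeqs k (suc a) hi ] h (a ∷ t)
∑-incSeqs-head k lo hi h = trans (∑-concatMap (λ a → map (a ∷_) (incSeqs k (suc a) hi)) (range lo hi) h)
                                 (∑-ext (λ a → ∑-map (a ∷_) (incSeqs k (suc a) hi) h) (range lo hi))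

∑-incSeqs-last : ∀ k lo hi (h : List ℕ → ℕ) → 1 ≤ lo →
  ∑ (incSeqs (suc k) lo hi) h ≡ ∑[ c ∈ range lo hi ] ∑[ s ∈ incSeqs k lo (c ∸ 1) ] h (s ++ [ c ])
∑-incSeqs-last zero    lo hi h _ = ∑-incSeqs-head 0 lo hi h
∑-incSeqs-last (suc k) lo hi h 1≤lo = begin
  ∑ (incSeqs (suc (suc k)) lo hi) h
    ≡⟨ ∑-incSeqs-head (suc k) lo hi h ⟩
  ∑[ a ∈ range lo hi ] ∑[ t ∈ incSeqs (suc k) (suc a) hi ] h (a ∷ t)
    ≡⟨ ∑-ext (λ a → ∑-incSeqs-last k (suc a) hi (λ t → h (a ∷ t)) (s≤s z≤n)) (range lo hi) ⟩
  ∑[ a ∈ range lo hi ] ∑[ c ∈ range (suc a) hi ] ∑[ s ∈ incSeqs k (suc a) (c ∸ 1) ] h (a ∷ s ++ [ c ])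
    ≡⟨ ∑-triangle-range lo hi (λ a c → ∑[ s ∈ incSeqs k (suc a) (c ∸ 1) ] h (a ∷ s ++ [ c ])) 1≤lo ⟩
  ∑[ c ∈ range lo hi ] ∑[ a ∈ range lo (c ∸ 1) ] ∑[ s ∈ incSeqs k (suc a) (c ∸ 1) ] h (a ∷ s ++ [ c ])
    ≡⟨ ∑-ext (λ c → ∑-incSeqs-head k lo (c ∸ 1) (λ s → h (s ++ [ c ]))) (range lo hi) ⟨
  ∑[ c ∈ range lo hi ] ∑[ s ∈ incSeqs (suc k) lo (c ∸ 1) ] h (s ++ [ c ]) ∎

∑-incSeqs-short : ∀ k lo hi (h : List ℕ → ℕ) → hi < lo + k → ∑ (incSeqs (suc k) lo hi) h ≡ 0
∑-incSeqs-short zero    lo hi h hi<lo rewrite range-empty lo hi (subst (hi <_) (+-identityʳ lo) hi<lo) = refl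
∑-incSeqs-short (suc k) lo hi h hi<lo+1+k = begin
  ∑ (incSeqs (suc (suc k)) lo hi) h
    ≡⟨ ∑-incSeqs-head (suc k) lo hi h ⟩
  ∑[ a ∈ range lo hi ] ∑[ t ∈ incSeqs (suc k) (suc a) hi ] h (a ∷ t)
    ≡⟨ ∑-cong (λ {a} (lo≤a , _) → ∑-incSeqs-short k (suc a) hi (λ t → h (a ∷ t))
                 (≤-trans hi<lo+1+k (≤-trans (≤-reflexive (+-suc lo k)) (s≤s (+-monoˡ-≤ k lo≤a)))))
              (All-range lo hi) ⟩
  ∑[ _ ∈ range lo hi ] 0
    ≡⟨ ∑-zero (range lo hi) ⟩
  0 ∎

chainSum : ℕ → ℕ → ℕ
chainSum k n = ∑[ s ∈ incSeqs k 2 (n ∸ 1) ] chainProd (1 ∷ s ++ [ n ])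

rhs≡∑chainSum : ∀ n → rhs n ≡ ∑[ k ∈ interval 0 (n ∸ 1) ] chainSum k n
rhs≡∑chainSum n = begin
  rhs n
    ≡⟨ ∑-ext (λ k → ∑-map (λ s → 1 ∷ s ++ [ n ]) (incSeqs k 2 (n ∸ 1)) chainProd) (upTo (n ∸ 1)) ⟩
  ∑[ k ∈ upTo (n ∸ 1) ] chainSum k n
    ≡⟨ cong (λ ks → ∑[ k ∈ ks ] chainSum k n) (upTo≡interval (n ∸ 1)) ⟩
  ∑[ k ∈ interval 0 (n ∸ 1) ] chainSum k n ∎

chainProd-snoc : ∀ x s c n → chainProd (x ∷ (s ++ [ c ]) ++ [ n ]) ≡ chainProd (x ∷ s ++ [ c ]) * factor c n
chainProd-snoc x []      c n =
  trans (cong (factor x c *_) (*-identityʳ (factor c n))) (cong (_* factor c n) (sym (*-identityʳ (factor x c))))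
chainProd-snoc x (y ∷ s) c n =
  trans (cong (factor x y *_) (chainProd-snoc y s c n)) (sym (*-assoc (factor x y) (chainProd (y ∷ s ++ [ c ])) (factor c n)))

chainSum-suc : ∀ k n → chainSum (suc k) n ≡ ∑[ c ∈ range 2 (n ∸ 1) ] (chainSum k c * factor c n)
chainSum-suc k n = begin
  chainSum (suc k) n
    ≡⟨ ∑-incSeqs-last k 2 (n ∸ 1) (λ s → chainProd (1 ∷ s ++ [ n ])) (s≤s z≤n) ⟩
  ∑[ c ∈ range 2 (n ∸ 1) ] ∑[ s ∈ incSeqs k 2 (c ∸ 1) ] chainProd (1 ∷ (s ++ [ c ]) ++ [ n ])
    ≡⟨ ∑-ext (λ c → ∑-ext (λ s → chainProd-snoc 1 s c n) (incSeqs k 2 (c ∸ 1))) (range 2 (n ∸ 1)) ⟩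
  ∑[ c ∈ range 2 (n ∸ 1) ] ∑[ s ∈ incSeqs k 2 (c ∸ 1) ] (chainProd (1 ∷ s ++ [ c ]) * factor c n)
    ≡⟨ ∑-ext (λ c → ∑-*ʳ (factor c n) (λ s → chainProd (1 ∷ s ++ [ c ])) (incSeqs k 2 (c ∸ 1))) (range 2 (n ∸ 1)) ⟩
  ∑[ c ∈ range 2 (n ∸ 1) ] (chainSum k c * factor c n) ∎

-- A chain from 1 to c has at most c - 2 interior points, so the sum
-- defining rhs c may be extended to any number m ≥ c - 1 of terms.
rhs-extend : ∀ c m → 2 ≤ c → c ∸ 1 ≤ m → ∑[ k ∈ interval 0 m ] chainSum k c ≡ rhs c
rhs-extend c m 2≤c c∸1≤m = begin
  ∑[ k ∈ interval 0 m ] chainSum k c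
    ≡⟨ cong (λ ks → ∑[ k ∈ ks ] chainSum k c)
            (trans (cong (interval 0) (sym (m+[n∸m]≡n c∸1≤m))) (interval-++ 0 (c ∸ 1) (m ∸ (c ∸ 1)))) ⟩
  ∑[ k ∈ interval 0 (c ∸ 1) ++ interval (c ∸ 1) (m ∸ (c ∸ 1)) ] chainSum k c
    ≡⟨ ∑-++ (interval 0 (c ∸ 1)) (interval (c ∸ 1) (m ∸ (c ∸ 1))) (λ k → chainSum k c) ⟩
  ∑[ k ∈ interval 0 (c ∸ 1) ] chainSum k c + ∑[ k ∈ interval (c ∸ 1) (m ∸ (c ∸ 1)) ] chainSum k c
    ≡⟨ cong (∑[ k ∈ interval 0 (c ∸ 1) ] chainSum k c +_) (∑-vanish (interval (c ∸ 1) (m ∸ (c ∸ 1)))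
         (λ k∈ → too-long (proj₁ (All.lookup (All-interval (c ∸ 1) (m ∸ (c ∸ 1))) k∈)))) ⟩
  ∑[ k ∈ interval 0 (c ∸ 1) ] chainSum k c + 0
    ≡⟨ +-identityʳ _ ⟩
  ∑[ k ∈ interval 0 (c ∸ 1) ] chainSum k c
    ≡⟨ rhs≡∑chainSum c ⟨
  rhs c ∎
  where
  too-long : ∀ {k} → c ∸ 1 ≤ k → chainSum k c ≡ 0
  too-long {zero}  c∸1≤0 = ⊥-elim (<⇒≱ (∸-monoˡ-≤ 1 2≤c) c∸1≤0)
  too-long {suc k} c∸1≤1+k = ∑-incSeqs-short k 2 (c ∸ 1) (λ s → chainProd (1 ∷ s ++ [ c ])) (s≤s c∸1≤1+k)

rhs-recursion : ∀ n → 2 ≤ n → rhs n ≡ factor 1 n + ∑[ c ∈ range 2 (n ∸ 1) ] (rhs c * factor c n)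
rhs-recursion n@(suc (suc b)) (s≤s (s≤s z≤n)) = begin
  rhs n
    ≡⟨ rhs≡∑chainSum n ⟩
  chainSum 0 n + ∑[ k ∈ interval 1 b ] chainSum k n
    ≡⟨ cong₂ _+_ (trans (+-identityʳ (factor 1 n * 1)) (*-identityʳ (factor 1 n)))
                 (trans (cong (λ ks → ∑[ k ∈ ks ] chainSum k n) (interval-suc 0 b))
                        (∑-map suc (interval 0 b) (λ k → chainSum k n))) ⟩
  factor 1 n + ∑[ k ∈ interval 0 b ] chainSum (suc k) n
    ≡⟨ cong (factor 1 n +_) (begin
         ∑[ k ∈ interval 0 b ] chainSum (suc k) n
           ≡⟨ ∑-ext (λ k → chainSum-suc k n) (interval 0 b) ⟩
         ∑[ k ∈ interval 0 b ] ∑[ c ∈ range 2 (suc b) ] (chainSum k c * factor c n)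
           ≡⟨ ∑-swap (interval 0 b) (range 2 (suc b)) (λ k c → chainSum k c * factor c n) ⟩
         ∑[ c ∈ range 2 (suc b) ] ∑[ k ∈ interval 0 b ] (chainSum k c * factor c n)
           ≡⟨ ∑-cong (λ {c} (2≤c , c≤1+b) → trans (∑-*ʳ (factor c n) (λ k → chainSum k c) (interval 0 b))
                         (cong (_* factor c n) (rhs-extend c b 2≤c (∸-monoˡ-≤ 1 c≤1+b))))
                     (All-range 2 (suc b)) ⟩
         ∑[ c ∈ range 2 (suc b) ] (rhs c * factor c n) ∎) ⟩
  factor 1 n + ∑[ c ∈ range 2 (suc b) ] (rhs c * factor c n) ∎

κ-recursion′ : ∀ n → 2 ≤ n → κ n ≡ factor 1 n + ∑[ c ∈ range 2 (n ∸ 1) ] (κ c * factor c n)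
κ-recursion′ n 2≤n = begin
  κ n
    ≡⟨ κ-recursion n 2≤n ⟩
  ∑[ a ∈ range 1 (n ∸ 1) ] (κ a * tailPairs a (n ∸ a))
    ≡⟨ ∑-cong (λ {a} (1≤a , a≤n∸1) → cong (κ a *_) (tailPairs≡factor a n 1≤a (below-n a≤n∸1))) (All-range 1 (n ∸ 1)) ⟩
  ∑[ a ∈ range 1 (n ∸ 1) ] (κ a * factor a n)
    ≡⟨ cong (λ as → ∑[ a ∈ as ] (κ a * factor a n)) (range-cons 1 (n ∸ 1) (∸-monoˡ-≤ 1 2≤n)) ⟩
  κ 1 * factor 1 n + ∑[ c ∈ range 2 (n ∸ 1) ] (κ c * factor c n)
    ≡⟨ cong (_+ ∑[ c ∈ range 2 (n ∸ 1) ] (κ c * factor c n)) (*-identityˡ (factor 1 n)) ⟩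
  factor 1 n + ∑[ c ∈ range 2 (n ∸ 1) ] (κ c * factor c n) ∎
  where
  below-n : ∀ {a} → a ≤ n ∸ 1 → a < n
  below-n a≤n∸1 = subst (_ <_) (m+[n∸m]≡n (≤-trans (s≤s z≤n) 2≤n)) (s≤s a≤n∸1)

Recursion : (ℕ → ℕ → ℕ) → (ℕ → ℕ) → Set
Recursion w f = ∀ n → 2 ≤ n → f n ≡ w 1 n + ∑[ c ∈ range 2 (n ∸ 1) ] (f c * w c n)

recursion-unique : ∀ w f g → Recursion w f → Recursion w g → ∀ n → 2 ≤ n → f n ≡ g n
recursion-unique w f g rec-f rec-g = <-rec (λ n → 2 ≤ n → f n ≡ g n) step
  where
  step : ∀ n → (∀ {m} → m < n → 2 ≤ m → f m ≡ g m) → 2 ≤ n → f n ≡ g n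
  step n ih 2≤n = begin
    f n                                                   ≡⟨ rec-f n 2≤n ⟩
    w 1 n + ∑[ c ∈ range 2 (n ∸ 1) ] (f c * w c n)         ≡⟨ cong (w 1 n +_) (∑-cong same (All-range 2 (n ∸ 1))) ⟩
    w 1 n + ∑[ c ∈ range 2 (n ∸ 1) ] (g c * w c n)         ≡⟨ rec-g n 2≤n ⟨
    g n                                                   ∎
    where
    same : ∀ {c} → 2 ≤ c × c ≤ n ∸ 1 → f c * w c n ≡ g c * w c n
    same {c} (2≤c , c≤n∸1) = cong (_* w c n) (ih (subst (c <_) (m+[n∸m]≡n (≤-trans (s≤s z≤n) 2≤n)) (s≤s c≤n∸1)) 2≤c)

theorem3p4 : (n : ℕ) → 2 ≤ n → κ n ≡ rhs n
theorem3p4 = recursion-unique factor κ rhs κ-recursion′ rhs-recursion
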